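{- Let $\Gamma$ be an $n$-vertex (simple) graph, and let $M$ be a matching of $m$ edges of $\Gamma$. Suppose that $V_1,\dots,V_k$ are pairwise disjoint vertex sets, each containing at least one edge of $M$, and such that for each $i$, every vertex in $V(M) \cap V_i$ has at least $4$ neighbours in $V_i$. Then \[ \mathrm{mis}(\Gamma) \leq \left(\frac{59}{64}\right)^{k}2^{3m-n}3^{n-2m}. \]
   Context: $\mathrm{mis}(\Gamma)$ denotes the number of maximal (with respect to inclusion) independent sets of $\Gamma$; $V(M)$ is the set of vertices covered by $M$. -}

module Defs where

open import Data.Nat using (ℕ; zero; suc; _+_; _*_; _∸_; _^_; _≤_)
open import Data.Bool using (Bool; true; false; _∧_; _∨_; not; if_then_else_)
open import Data.Fin using (Fin)
open import Data.Vec using (Vec; []; _∷_; lookup)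
open import Data.List using (List; []; _∷_; map; _++_; length; filterᵇ; allFin)
open import Data.Bool.ListAction using () renaming (all to allL)
open import Data.Product using (Σ; _×_; _,_; proj₁; proj₂; ∃-syntax)
open import Data.Sum using (_⊎_)
open import Relation.Binary.PropositionalEquality using (_≡_; _≢_)

record Graph (n : ℕ) : Set where
  field
    adj    : Fin n → Fin n → Bool
    sym    : ∀ u v → adj u v ≡ adj v u
    irrefl : ∀ v → adj v v ≡ false
open Graph public

VSet : ℕ → Set
VSet n = Vec Bool n

_∈ᵇ_ : ∀ {n} → Fin n → VSet n → Bool
v ∈ᵇ S = lookup S v

_∈_ : ∀ {n} → Fin n → VSet n → Set
v ∈ S = lookup S v ≡ true

allV : ∀ {n} → (Fin n → Bool) → Bool
allV {n} p = allL p (allFin n)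

allSubsets : (n : ℕ) → List (VSet n)
allSubsets zero = [] ∷ []
allSubsets (suc n) = map (false ∷_) (allSubsets n) ++ map (true ∷_) (allSubsets n)

independentᵇ : ∀ {n} → Graph n → VSet n → Bool
independentᵇ Γ S = allV λ u → allV λ v → not (u ∈ᵇ S ∧ v ∈ᵇ S ∧ adj Γ u v)

_⊆ᵇ_ : ∀ {n} → VSet n → VSet n → Bool
S ⊆ᵇ T = allV λ v → not (v ∈ᵇ S) ∨ v ∈ᵇ T

_==ᵇ_ : ∀ {n} → VSet n → VSet n → Bool
S ==ᵇ T = (S ⊆ᵇ T) ∧ (T ⊆ᵇ S)

maximalIndependentᵇ : ∀ {n} → Graph n → VSet n → Bool
maximalIndependentᵇ {n} Γ S =
  independentᵇ Γ S ∧
  allL (λ T → not (independentᵇ Γ T ∧ (S ⊆ᵇ T)) ∨ (T ==ᵇ S)) (allSubsets n)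

mis : ∀ {n} → Graph n → ℕ
mis {n} Γ = length (filterᵇ (maximalIndependentᵇ Γ) (allSubsets n))

record Matching {n : ℕ} (Γ : Graph n) (m : ℕ) : Set where
  field
    edge     : Fin m → Fin n × Fin n
    isEdge   : ∀ e → adj Γ (proj₁ (edge e)) (proj₂ (edge e)) ≡ true
    disjoint : ∀ e f → e ≢ f →
               proj₁ (edge e) ≢ proj₁ (edge f) × proj₁ (edge e) ≢ proj₂ (edge f) ×
               proj₂ (edge e) ≢ proj₁ (edge f) × proj₂ (edge e) ≢ proj₂ (edge f)
open Matching public

covered : ∀ {n m} {Γ : Graph n} → Matching Γ m → Fin n → Set
covered M v = ∃[ e ] (v ≡ proj₁ (edge M e) ⊎ v ≡ proj₂ (edge M e))

degIn : ∀ {n} → Graph n → VSet n → Fin n → ℕ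
degIn {n} Γ W v = length (filterᵇ (λ u → adj Γ v u ∧ u ∈ᵇ W) (allFin n))

{-# OPTIONS --safe #-}
-- For a vertex set C let Φ C = 2^(n − |C|) · 8^(edges of M inside C) · 3^(vertices of C without
-- partner in C), which is 2^n times the bound of the statement for the subgraph induced by C.
-- Deleting one vertex multiplies Φ by at most 3/4, and by 2/3 if its partner is already gone.
-- 2^n · mis(Γ[C]) ≤ Φ C follows by induction on |C|: every maximal independent set contains a chosen
-- vertex or one of its neighbours, and choosing a vertex deletes its closed neighbourhood, so a case
-- analysis on the degrees of a vertex and of its partner yields branchings whose factors add up to at
-- most 1.  For each V i, branching on whether the matched edge xy of V i meets the independent set at x,
-- at y, or not at all, and charging x and y together with three further V i-neighbours of x (or of y),
-- costs 27/128 + 27/128 + 1/2 = 59/64.  As the V i are disjoint these branchings do not interfere.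
module Submission where

open import Defs hiding (sym)
open import Data.Bool using (Bool; true; false; not; _∧_; _∨_; if_then_else_; T)
import Data.Bool.Properties as Boolₚ
open import Data.Fin as Fin using (Fin; zero; suc)
import Data.Fin.Properties as Finₚ
open import Data.List using (List; []; _∷_; _++_; map; length; filter; filterᵇ; allFin)
open import Data.List.Membership.Propositional using () renaming (_∈_ to _∈ˡ_)
open import Data.List.Membership.Propositional.Properties using (∈-filter⁺; ∈-filter⁻; ∈-allFin; ∈-++⁺ˡ; ∈-++⁺ʳ; ∈-map⁺)
open import Data.List.Properties using (length-filter; filter-all)
open import Data.List.Relation.Unary.All as All using (All; []; _∷_)
import Data.List.Relation.Unary.All.Properties as Allₚ
open import Data.List.Relation.Unary.AllPairs using ([]; _∷_)
import Data.List.Relation.Unary.Any as Any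
open import Data.List.Relation.Unary.Any using (here; there)
open import Data.List.Relation.Unary.Unique.Propositional using (Unique)
import Data.List.Relation.Unary.Unique.Propositional.Properties as Uniqueₚ
open import Data.Nat using (ℕ; zero; suc; _+_; _*_; _^_; _∸_; _≤_; _<_; _≤ᵇ_; z≤n; s≤s; NonZero)
open import Data.Nat.Induction using (<-wellFounded)
open import Data.Nat.Properties
open import Algebra.Properties.CommutativeSemigroup *-commutativeSemigroup using (x∙yz≈y∙xz; xy∙z≈y∙xz; interchange)
open import Data.Nat.Solver using (module +-*-Solver)
open import Data.Product using (∃-syntax; _×_; _,_; proj₁; proj₂)
open import Data.Sum using (_⊎_; inj₁; inj₂)
open import Data.Unit using (tt)
open import Data.Vec using (Vec; []; _∷_; lookup; _[_]≔_)
open import Data.Vec.Properties using (lookup∘update; lookup∘update′)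
open import Function using (_∘_; id; Injective)
open import Function.Bundles using (Equivalence)
open import Induction.WellFounded using (WellFounded; WfRec)
import Induction.WellFounded as WF
open import Level using (0ℓ)
open import Relation.Binary.PropositionalEquality
import Relation.Binary.Construct.On as On
open import Relation.Nullary using (¬_; ¬?; Dec; T?; does; yes; no; contradiction; _⊎-dec_; _×-dec_; _→-dec_)
import Relation.Nullary.Decidable as Dec
open import Relation.Nullary.Decidable using (dec-true; dec-false)
open import Relation.Unary using (Pred; Decidable)

∏ : ∀ {k} → (Fin k → ℕ) → ℕ
∏ {zero}  f = 1
∏ {suc k} f = f zero * ∏ (f ∘ suc)

∏-cong : ∀ {k} {f g : Fin k → ℕ} → (∀ i → f i ≡ g i) → ∏ f ≡ ∏ g
∏-cong {zero}  f≗g = refl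
∏-cong {suc k} f≗g = cong₂ _*_ (f≗g zero) (∏-cong (f≗g ∘ suc))

∏-update : ∀ {k} (f g : Fin k → ℕ) i → (∀ j → j ≢ i → f j ≡ g j) → g i * ∏ f ≡ f i * ∏ g
∏-update f g zero f≗g = begin
  g zero * (f zero * ∏ (f ∘ suc)) ≡⟨ cong (λ t → g zero * (f zero * t)) (∏-cong (λ j → f≗g (suc j) λ ())) ⟩
  g zero * (f zero * ∏ (g ∘ suc)) ≡⟨ x∙yz≈y∙xz (g zero) (f zero) _ ⟩
  f zero * (g zero * ∏ (g ∘ suc)) ∎
  where open ≡-Reasoning
∏-update f g (suc i) f≗g = begin
  g (suc i) * (f zero * ∏ (f ∘ suc)) ≡⟨ x∙yz≈y∙xz (g (suc i)) (f zero) _ ⟩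
  f zero * (g (suc i) * ∏ (f ∘ suc)) ≡⟨ cong₂ _*_ (f≗g zero λ ()) (∏-update (f ∘ suc) (g ∘ suc) i
                                           λ j j≢i → f≗g (suc j) (j≢i ∘ Finₚ.suc-injective)) ⟩
  g zero * (f (suc i) * ∏ (g ∘ suc)) ≡⟨ x∙yz≈y∙xz (g zero) (f (suc i)) _ ⟩
  f (suc i) * (g zero * ∏ (g ∘ suc)) ∎
  where open ≡-Reasoning

∏-const : ∀ {k} a → ∏ {k} (λ _ → a) ≡ a ^ k
∏-const {zero}  a = refl
∏-const {suc k} a = cong (a *_) (∏-const {k} a)

∣_∣ : ∀ {k} → (Fin k → Bool) → ℕ
∣_∣ {zero}  p = 0
∣_∣ {suc k} p = (if p zero then 1 else 0) + ∣ p ∘ suc ∣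

∏-if : ∀ {k} (p : Fin k → Bool) a → ∏ (λ i → if p i then 1 else a) ≡ a ^ ∣ not ∘ p ∣
∏-if {zero}  p a = refl
∏-if {suc k} p a with p zero
... | true  = trans (+-identityʳ _) (∏-if (p ∘ suc) a)
... | false = cong (a *_) (∏-if (p ∘ suc) a)

infixl 6 _─_
_─_ : ∀ {k} → (Fin k → Bool) → Fin k → (Fin k → Bool)
(p ─ i) v = if does (v Finₚ.≟ i) then false else p v

module _ {k} {p : Fin k → Bool} {i : Fin k} where

  ─-self : (p ─ i) i ≡ false
  ─-self rewrite dec-true (i Finₚ.≟ i) refl = refl

  ─-other : ∀ {v} → v ≢ i → (p ─ i) v ≡ p v
  ─-other {v} v≢i rewrite dec-false (v Finₚ.≟ i) v≢i = refl

  ∈-─⁺ : ∀ {v} → p v ≡ true → v ≢ i → (p ─ i) v ≡ true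
  ∈-─⁺ pv v≢i = trans (─-other v≢i) pv

  ∈-─⁻ : ∀ {v} → (p ─ i) v ≡ true → p v ≡ true × v ≢ i
  ∈-─⁻ {v} h with v Finₚ.≟ i
  ... | no v≢i = h , v≢i

∣∣-mono : ∀ {k} {p q : Fin k → Bool} → (∀ i → p i ≡ true → q i ≡ true) → ∣ p ∣ ≤ ∣ q ∣
∣∣-mono {zero}          p⊆q = z≤n
∣∣-mono {suc k} {p} {q} p⊆q with p zero in p₀ | q zero in q₀
... | false | false = ∣∣-mono (p⊆q ∘ suc)
... | false | true  = m≤n⇒m≤1+n (∣∣-mono (p⊆q ∘ suc))
... | true  | true  = s≤s (∣∣-mono (p⊆q ∘ suc))
... | true  | false with () ← trans (sym (p⊆q zero p₀)) q₀

∣─∣ : ∀ {k} {p : Fin k → Bool} {i} → p i ≡ true → ∣ p ∣ ≡ suc ∣ p ─ i ∣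
∣─∣ {suc k} {p} {zero}  pi rewrite pi = refl
∣─∣ {suc k} {p} {suc i} pi =
  trans (cong ((if p zero then 1 else 0) +_) (∣─∣ {p = p ∘ suc} pi)) (+-suc _ _)

∣∣-complement : ∀ {k} (p : Fin k → Bool) → ∣ p ∣ + ∣ not ∘ p ∣ ≡ k
∣∣-complement {zero}  p = refl
∣∣-complement {suc k} p with p zero
... | true  = cong suc (∣∣-complement (p ∘ suc))
... | false = trans (+-suc _ _) (cong suc (∣∣-complement (p ∘ suc)))

∣∣-injective : ∀ {j k} {p : Fin k → Bool} (f : Fin j → Fin k) → Injective _≡_ _≡_ f →
               (∀ i → p (f i) ≡ true) → j ≤ ∣ p ∣
∣∣-injective {zero}  f inj pf = z≤n
∣∣-injective {suc j} {p = p} f inj pf = subst (suc j ≤_) (sym (∣─∣ {p = p} (pf zero)))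
  (s≤s (∣∣-injective {p = p ─ f zero} (f ∘ suc) (Finₚ.suc-injective ∘ inj)
    λ i → ∈-─⁺ {p = p} (pf (suc i)) (Finₚ.0≢1+n ∘ sym ∘ inj)))

-- x ≤ (p / q) · y.  A data type rather than a function, so that unification recovers p and q instead
-- of unfolding the products q * x and p * y.
infix 4 _≤[_/_]_
data _≤[_/_]_ (x p q y : ℕ) : Set where
  *≤* : q * x ≤ p * y → x ≤[ p / q ] y

drop-*≤* : ∀ {x p q y} → x ≤[ p / q ] y → q * x ≤ p * y
drop-*≤* (*≤* q*x≤p*y) = q*x≤p*y

module _ where
  open +-*-Solver
  open ≤-Reasoning

  ≤[]-trans : ∀ {x y z p q p′ q′} → x ≤[ p / q ] y → y ≤[ p′ / q′ ] z → x ≤[ p * p′ / q * q′ ] z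
  ≤[]-trans {x} {y} {z} {p} {q} {p′} {q′} (*≤* x≤y) (*≤* y≤z) = *≤* (begin
    q * q′ * x   ≡⟨ xy∙z≈y∙xz q q′ x ⟩
    q′ * (q * x) ≤⟨ *-monoʳ-≤ q′ x≤y ⟩
    q′ * (p * y) ≡⟨ x∙yz≈y∙xz q′ p y ⟩
    p * (q′ * y) ≤⟨ *-monoʳ-≤ p y≤z ⟩
    p * (p′ * z) ≡⟨ *-assoc p p′ z ⟨
    p * p′ * z   ∎)

  +-mono-≤[] : ∀ {x y x′ y′ p q} → x ≤[ p / q ] x′ → y ≤[ p / q ] y′ → x + y ≤[ p / q ] x′ + y′
  +-mono-≤[] {x} {y} {x′} {y′} {p} {q} (*≤* x≤x′) (*≤* y≤y′) = *≤* (begin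
    q * (x + y)      ≡⟨ *-distribˡ-+ q x y ⟩
    q * x + q * y    ≤⟨ +-mono-≤ x≤x′ y≤y′ ⟩
    p * x′ + p * y′  ≡⟨ *-distribˡ-+ p x′ y′ ⟨
    p * (x′ + y′)    ∎)

  ≤[]-+ : ∀ {x y z p q p′ q′} → x ≤[ p / q ] z → y ≤[ p′ / q′ ] z → x + y ≤[ p * q′ + p′ * q / q * q′ ] z
  ≤[]-+ {x} {y} {z} {p} {q} {p′} {q′} (*≤* x≤z) (*≤* y≤z) = *≤* (begin
    q * q′ * (x + y)
      ≡⟨ solve 4 (λ q q′ x y → q :* q′ :* (x :+ y) := q′ :* (q :* x) :+ q :* (q′ :* y)) refl q q′ x y ⟩
    q′ * (q * x) + q * (q′ * y)
      ≤⟨ +-mono-≤ (*-monoʳ-≤ q′ x≤z) (*-monoʳ-≤ q y≤z) ⟩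
    q′ * (p * z) + q * (p′ * z)
      ≡⟨ solve 5 (λ q q′ p p′ z → q′ :* (p :* z) :+ q :* (p′ :* z) := (p :* q′ :+ p′ :* q) :* z) refl q q′ p p′ z ⟩
    (p * q′ + p′ * q) * z
      ∎)

  ≤-≤[]-trans : ∀ {x y z p q} → x ≤ y → y ≤[ p / q ] z → x ≤[ p / q ] z
  ≤-≤[]-trans {q = q} x≤y (*≤* y≤z) = *≤* (≤-trans (*-monoʳ-≤ q x≤y) y≤z)

  ≤[]⇒≤ : ∀ {x y p q} .{{_ : NonZero q}} → p ≤ q → x ≤[ p / q ] y → x ≤ y
  ≤[]⇒≤ {x} {y} {p} {q} p≤q (*≤* x≤y) = *-cancelˡ-≤ q (≤-trans x≤y (*-monoˡ-≤ y p≤q))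

  ≤[]-weaken : ∀ {x y p q p′ q′} .{{_ : NonZero q}} → p * q′ ≤ p′ * q → x ≤[ p / q ] y → x ≤[ p′ / q′ ] y
  ≤[]-weaken {x} {y} {p} {q} {p′} {q′} pq′≤p′q (*≤* x≤y) = *≤* (*-cancelˡ-≤ q (begin
    q * (q′ * x) ≡⟨ x∙yz≈y∙xz q q′ x ⟩
    q′ * (q * x) ≤⟨ *-monoʳ-≤ q′ x≤y ⟩
    q′ * (p * y) ≡⟨ solve 3 (λ q′ p y → q′ :* (p :* y) := (p :* q′) :* y) refl q′ p y ⟩
    p * q′ * y   ≤⟨ *-monoˡ-≤ y pq′≤p′q ⟩
    p′ * q * y   ≡⟨ solve 3 (λ p′ q y → p′ :* q :* y := q :* (p′ :* y)) refl p′ q y ⟩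
    q * (p′ * y) ∎))

*-ratio : ∀ {a b c d V V′ E E′} → a * V ≡ b * V′ → c * E ≡ d * E′ → b * d * (V′ * E′) ≡ a * c * (V * E)
*-ratio {a} {b} {c} {d} {V} {V′} {E} {E′} aV≡bV′ cE≡dE′ = begin
  b * d * (V′ * E′)   ≡⟨ interchange b d V′ E′ ⟩
  b * V′ * (d * E′)   ≡⟨ cong₂ _*_ aV≡bV′ cE≡dE′ ⟨
  a * V * (c * E)     ≡⟨ interchange a V c E ⟩
  a * c * (V * E)     ∎
  where open ≡-Reasoning

count : ∀ {A : Set} {P : Pred A 0ℓ} → Decidable P → List A → ℕ
count P? xs = length (filter P? xs)

module _ {A : Set} {P Q : Pred A 0ℓ} (P? : Decidable P) (Q? : Decidable Q) where

  count-mono : (∀ {x} → P x → Q x) → ∀ xs → count P? xs ≤ count Q? xs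
  count-mono P⊆Q []       = z≤n
  count-mono P⊆Q (x ∷ xs) with P? x | Q? x
  ... | yes _  | yes _  = s≤s (count-mono P⊆Q xs)
  ... | no _   | yes _  = m≤n⇒m≤1+n (count-mono P⊆Q xs)
  ... | no _   | no _   = count-mono P⊆Q xs
  ... | yes px | no ¬qx = contradiction (P⊆Q px) ¬qx

module _ {A : Set} {P : Pred A 0ℓ} (P? : Decidable P) where

  count-none : (∀ {x} → ¬ P x) → ∀ xs → count P? xs ≡ 0
  count-none ¬P []       = refl
  count-none ¬P (x ∷ xs) with P? x
  ... | yes px = contradiction px ¬P
  ... | no _   = count-none ¬P xs

  count-++ : ∀ xs ys → count P? (xs ++ ys) ≡ count P? xs + count P? ys
  count-++ []       ys = refl
  count-++ (x ∷ xs) ys with P? x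
  ... | yes _ = cong suc (count-++ xs ys)
  ... | no _  = count-++ xs ys

  count-map : ∀ {B : Set} (f : B → A) xs → count P? (map f xs) ≡ count (P? ∘ f) xs
  count-map f []       = refl
  count-map f (x ∷ xs) with P? (f x)
  ... | yes _ = cong suc (count-map f xs)
  ... | no _  = count-map f xs

module _ {A : Set} {P Q : Pred A 0ℓ} (P? : Decidable P) (Q? : Decidable Q) where

  count-split : ∀ xs → count P? xs ≤ count (λ x → P? x ×-dec Q? x) xs + count (λ x → P? x ×-dec ¬? (Q? x)) xs
  count-split []       = z≤n
  count-split (x ∷ xs) with P? x | Q? x
  ... | no _  | _     = count-split xs
  ... | yes _ | yes _ = s≤s (count-split xs)
  ... | yes _ | no _  = subst (suc (count P? xs) ≤_) (sym (+-suc _ _)) (s≤s (count-split xs))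

module _ {n} {P : Pred (Vec Bool (suc n)) 0ℓ} (P? : Decidable P) where

  count-allSubsets-suc : count P? (allSubsets (suc n)) ≡
    count (P? ∘ (false ∷_)) (allSubsets n) + count (P? ∘ (true ∷_)) (allSubsets n)
  count-allSubsets-suc = trans (count-++ P? (map (false ∷_) (allSubsets n)) _)
    (cong₂ _+_ (count-map P? (false ∷_) (allSubsets n)) (count-map P? (true ∷_) (allSubsets n)))

-- S ↦ S [ c ]≔ false is injective on the vectors S with S c = true.
count-allSubsets-clear : ∀ {n} {P Q : Pred (Vec Bool n) 0ℓ} (P? : Decidable P) (Q? : Decidable Q) c →
  (∀ {S} → P S → lookup S c ≡ true × Q (S [ c ]≔ false)) →
  count P? (allSubsets n) ≤ count Q? (allSubsets n)
count-allSubsets-clear {suc n} P? Q? zero h = begin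
  count P? (allSubsets (suc n))                          ≡⟨ count-allSubsets-suc P? ⟩
  count (P? ∘ (false ∷_)) all + count (P? ∘ (true ∷_)) all
    ≡⟨ cong (_+ count (P? ∘ (true ∷_)) all) (count-none (P? ∘ (false ∷_)) (λ p → contradiction (proj₁ (h p)) λ ()) all) ⟩
  count (P? ∘ (true ∷_)) all                             ≤⟨ count-mono (P? ∘ (true ∷_)) (Q? ∘ (false ∷_)) (proj₂ ∘ h) all ⟩
  count (Q? ∘ (false ∷_)) all                            ≤⟨ m≤m+n _ _ ⟩
  count (Q? ∘ (false ∷_)) all + count (Q? ∘ (true ∷_)) all ≡⟨ count-allSubsets-suc Q? ⟨
  count Q? (allSubsets (suc n))                          ∎
  where
  open ≤-Reasoning
  all = allSubsets n
count-allSubsets-clear {suc n} P? Q? (suc c) h = begin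
  count P? (allSubsets (suc n))                            ≡⟨ count-allSubsets-suc P? ⟩
  count (P? ∘ (false ∷_)) all + count (P? ∘ (true ∷_)) all
    ≤⟨ +-mono-≤ (count-allSubsets-clear (P? ∘ (false ∷_)) (Q? ∘ (false ∷_)) c h)
                (count-allSubsets-clear (P? ∘ (true ∷_)) (Q? ∘ (true ∷_)) c h) ⟩
  count (Q? ∘ (false ∷_)) all + count (Q? ∘ (true ∷_)) all ≡⟨ count-allSubsets-suc Q? ⟨
  count Q? (allSubsets (suc n))                            ∎
  where
  open ≤-Reasoning
  all = allSubsets n

count-allSubsets-≤1 : ∀ {n} {P : Pred (Vec Bool n) 0ℓ} (P? : Decidable P) →
  (∀ {S} → P S → ∀ i → lookup S i ≡ false) → count P? (allSubsets n) ≤ 1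
count-allSubsets-≤1 {zero}  P? h = length-filter P? (allSubsets 0)
count-allSubsets-≤1 {suc n} P? h = begin
  count P? (allSubsets (suc n))                                        ≡⟨ count-allSubsets-suc P? ⟩
  count (P? ∘ (false ∷_)) all + count (P? ∘ (true ∷_)) all
    ≡⟨ cong (count (P? ∘ (false ∷_)) all +_) (count-none (P? ∘ (true ∷_)) (λ p → contradiction (h p zero) λ ()) all) ⟩
  count (P? ∘ (false ∷_)) all + 0
    ≤⟨ +-monoˡ-≤ 0 (count-allSubsets-≤1 (P? ∘ (false ∷_)) (λ p i → h p (suc i))) ⟩
  1 ∎
  where
  open ≤-Reasoning
  all = allSubsets n

∈-allSubsets : ∀ {n} (S : VSet n) → S ∈ˡ allSubsets n
∈-allSubsets []          = here refl
∈-allSubsets (false ∷ S) = ∈-++⁺ˡ (∈-map⁺ (false ∷_) (∈-allSubsets S))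
∈-allSubsets (true ∷ S)  = ∈-++⁺ʳ (map (false ∷_) (allSubsets _)) (∈-map⁺ (true ∷_) (∈-allSubsets S))

T-∧ˡ : ∀ {a b} → T (a ∧ b) → T a
T-∧ˡ = proj₁ ∘ Equivalence.to Boolₚ.T-∧

T-∧ʳ : ∀ {a b} → T (a ∧ b) → T b
T-∧ʳ = proj₂ ∘ Equivalence.to Boolₚ.T-∧

T⇒≡ : ∀ {a} → T a → a ≡ true
T⇒≡ = Equivalence.to Boolₚ.T-≡

allV⁻ : ∀ {n} {p : Fin n → Bool} → T (allV p) → ∀ v → T (p v)
allV⁻ {n} {p} t v = All.lookup (Allₚ.all⁺ p (allFin n) t) (∈-allFin v)

allV⁺ : ∀ {n} {p : Fin n → Bool} → (∀ v → T (p v)) → T (allV p)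
allV⁺ {n} {p} h = Allₚ.all⁻ p {allFin n} (All.tabulate λ {v} _ → h v)

infixl 6 _∖_
_∖_ : ∀ {k} → (Fin k → Bool) → List (Fin k) → (Fin k → Bool)
p ∖ []      = p
p ∖ (x ∷ R) = (p ∖ R) ─ x

module _ {k} {p : Fin k → Bool} where

  ∈-∖⁺ : ∀ {v R} → p v ≡ true → All (v ≢_) R → (p ∖ R) v ≡ true
  ∈-∖⁺ pv []                      = pv
  ∈-∖⁺ {R = x ∷ R} pv (v≢x ∷ v∉R) = ∈-─⁺ {p = p ∖ R} (∈-∖⁺ pv v∉R) v≢x

  ∈-∖⁻ : ∀ {v R} → (p ∖ R) v ≡ true → p v ≡ true × All (v ≢_) R
  ∈-∖⁻ {R = []}    pv = pv , []
  ∈-∖⁻ {R = x ∷ R} h with ∈-─⁻ {p = p ∖ R} h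
  ... | h′ , v≢x = proj₁ (∈-∖⁻ {R = R} h′) , v≢x ∷ proj₂ (∈-∖⁻ {R = R} h′)

  ∉-∖ : ∀ {v R} → v ∈ˡ R → (p ∖ R) v ≡ false
  ∉-∖ {v} {x ∷ R} (here refl) = ─-self {p = p ∖ R}
  ∉-∖ {v} {x ∷ R} (there v∈R) with v Finₚ.≟ x
  ... | yes _ = refl
  ... | no _  = ∉-∖ v∈R

pattern ∈₀ = here refl
pattern ∈₁ = there ∈₀
pattern ∈₂ = there ∈₁
pattern ∈₃ = there ∈₂

module MatchingBound {n m : ℕ} (Γ : Graph n) (M : Matching Γ m) where

  VertexSet : Set
  VertexSet = Fin n → Bool

  infix 4 _⊆_
  _⊆_ : VertexSet → VertexSet → Set
  B ⊆ C = ∀ {v} → B v ≡ true → C v ≡ true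

  full : VertexSet
  full _ = true

  ∖-mono : ∀ {B C} R → B ⊆ C → B ∖ R ⊆ C ∖ R
  ∖-mono {B} {C} R B⊆C BRv = let Bv , v∉R = ∈-∖⁻ {p = B} {R = R} BRv in ∈-∖⁺ {p = C} (B⊆C Bv) v∉R

  adj⇒≢ : ∀ {u v} → adj Γ u v ≡ true → u ≢ v
  adj⇒≢ {u} uv refl with () ← trans (sym uv) (irrefl Γ u)

  adj-sym : ∀ {u v} → adj Γ u v ≡ true → adj Γ v u ≡ true
  adj-sym {u} {v} uv = trans (Graph.sym Γ v u) uv

  Endpoint : Fin n → Fin m → Set
  Endpoint v e = v ≡ proj₁ (edge M e) ⊎ v ≡ proj₂ (edge M e)

  endpoint? : ∀ v e → Dec (Endpoint v e)
  endpoint? v e = (v Finₚ.≟ proj₁ (edge M e)) ⊎-dec (v Finₚ.≟ proj₂ (edge M e))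

  endpoint-unique : ∀ {v e f} → Endpoint v e → Endpoint v f → e ≡ f
  endpoint-unique {v} {e} {f} ve vf with e Finₚ.≟ f
  ... | yes e≡f = e≡f
  ... | no e≢f with disjoint M e f e≢f | ve | vf
  ... | d , _ , _ , _ | inj₁ refl | inj₁ vf = contradiction vf d
  ... | _ , d , _ , _ | inj₁ refl | inj₂ vf = contradiction vf d
  ... | _ , _ , d , _ | inj₂ refl | inj₁ vf = contradiction vf d
  ... | _ , _ , _ , d | inj₂ refl | inj₂ vf = contradiction vf d

  data Link (e : Fin m) : Fin n → Fin n → Set where
    forward  : Link e (proj₁ (edge M e)) (proj₂ (edge M e))
    backward : Link e (proj₂ (edge M e)) (proj₁ (edge M e))

  endpoint-link : ∀ {x e} → Endpoint x e → ∃[ y ] Link e x y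
  endpoint-link (inj₁ refl) = _ , forward
  endpoint-link (inj₂ refl) = _ , backward

  Partners : Fin n → Fin n → Set
  Partners x y = ∃[ e ] Link e x y

  module _ {e : Fin m} {x y : Fin n} where

    link-endpoint : Link e x y → Endpoint x e
    link-endpoint forward  = inj₁ refl
    link-endpoint backward = inj₂ refl

    link-sym : Link e x y → Link e y x
    link-sym forward  = backward
    link-sym backward = forward

    link-adj : Link e x y → adj Γ x y ≡ true
    link-adj forward  = isEdge M e
    link-adj backward = trans (Graph.sym Γ _ _) (isEdge M e)

  partners-sym : ∀ {x y} → Partners x y → Partners y x
  partners-sym (e , l) = e , link-sym l

  partners-adj : ∀ {x y} → Partners x y → adj Γ x y ≡ true
  partners-adj (e , l) = link-adj l

  edge-ends-≢ : ∀ e → proj₁ (edge M e) ≢ proj₂ (edge M e)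
  edge-ends-≢ e = adj⇒≢ (isEdge M e)

  link-ends : ∀ {e x y} → Link e x y →
    (x ≡ proj₁ (edge M e) × y ≡ proj₂ (edge M e)) ⊎ (x ≡ proj₂ (edge M e) × y ≡ proj₁ (edge M e))
  link-ends forward  = inj₁ (refl , refl)
  link-ends backward = inj₂ (refl , refl)

  link-unique : ∀ {e x y z} → Link e x y → Link e x z → y ≡ z
  link-unique {e} l l′ with link-ends l | link-ends l′
  ... | inj₁ (_ , y≡) | inj₁ (_ , z≡) = trans y≡ (sym z≡)
  ... | inj₂ (_ , y≡) | inj₂ (_ , z≡) = trans y≡ (sym z≡)
  ... | inj₁ (x≡ , _) | inj₂ (x≡′ , _) = contradiction (trans (sym x≡) x≡′) (edge-ends-≢ e)
  ... | inj₂ (x≡ , _) | inj₁ (x≡′ , _) = contradiction (trans (sym x≡′) x≡) (edge-ends-≢ e)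

  partners-≢ : ∀ {x y} → Partners x y → x ≢ y
  partners-≢ = adj⇒≢ ∘ partners-adj

  partners-unique : ∀ {x y z} → Partners x y → Partners x z → y ≡ z
  partners-unique (e , l) (f , l′) with endpoint-unique (link-endpoint l) (link-endpoint l′)
  ... | refl = link-unique l l′

  Unpaired : VertexSet → Fin n → Set
  Unpaired C x = ∀ {y} → Partners x y → C y ≡ false

  matched? : ∀ v → Dec (∃[ e ] Endpoint v e)
  matched? v = Finₚ.any? (endpoint? v)

  Paired : VertexSet → Fin n → Set
  Paired C x = ∃[ y ] (Partners x y × C y ≡ true)

  paired-or-unpaired : ∀ C {x y} → Partners x y → Paired C x ⊎ Unpaired C x
  paired-or-unpaired C {y = y} xy with C y in Cy
  ... | true  = inj₁ (y , xy , Cy)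
  ... | false = inj₂ λ xz → subst (λ z → C z ≡ false) (partners-unique xy xz) Cy

  pairing : ∀ C x → Paired C x ⊎ Unpaired C x
  pairing C x with matched? x
  ... | no unmatched = inj₂ λ (e , l) → contradiction (e , link-endpoint l) unmatched
  ... | yes (e , xe) = paired-or-unpaired C (e , proj₂ (endpoint-link xe))

  -- The measure Φ

  matchedᵇ : Fin n → Bool
  matchedᵇ v = does (matched? v)

  -- Φ C is spread over vertices and edges so that deleting a vertex changes one factor of each
  -- product: a vertex outside C weighs 2, a vertex of C weighs 1 if M covers it and 3 otherwise,
  -- and an edge of M weighs 8, 3 or 1 according as 2, 1 or 0 of its ends lie in C.
  insideWeight : Fin n → ℕ
  insideWeight v = if matchedᵇ v then 1 else 3

  insideWeight-matched : ∀ {x e} → Endpoint x e → insideWeight x ≡ 1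
  insideWeight-matched {x} xe rewrite dec-true (matched? x) (_ , xe) = refl

  insideWeight-unmatched : ∀ {x} → ¬ (∃[ e ] Endpoint x e) → insideWeight x ≡ 3
  insideWeight-unmatched {x} unmatched rewrite dec-false (matched? x) unmatched = refl

  vertexWeight : VertexSet → Fin n → ℕ
  vertexWeight C v = if C v then insideWeight v else 2

  pairWeight : Bool → Bool → ℕ
  pairWeight true  true  = 8
  pairWeight true  false = 3
  pairWeight false true  = 3
  pairWeight false false = 1

  pairWeight-comm : ∀ a b → pairWeight a b ≡ pairWeight b a
  pairWeight-comm true  true  = refl
  pairWeight-comm true  false = refl
  pairWeight-comm false true  = refl
  pairWeight-comm false false = refl

  edgeWeight : VertexSet → Fin m → ℕ
  edgeWeight C e = pairWeight (C (proj₁ (edge M e))) (C (proj₂ (edge M e)))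

  Φ : VertexSet → ℕ
  Φ C = ∏ (vertexWeight C) * ∏ (edgeWeight C)

  Φ-ratio : ∀ a b c d {C D} → a * ∏ (vertexWeight C) ≡ b * ∏ (vertexWeight D) →
            c * ∏ (edgeWeight C) ≡ d * ∏ (edgeWeight D) → b * d * Φ D ≡ a * c * Φ C
  Φ-ratio a b c d {C} {D} = *-ratio {a} {b} {c} {d} {∏ (vertexWeight C)} {∏ (vertexWeight D)} {∏ (edgeWeight C)} {∏ (edgeWeight D)}

  module _ {C : VertexSet} {x : Fin n} (Cx : C x ≡ true) where

    ∏vertexWeight-─ : 2 * ∏ (vertexWeight C) ≡ insideWeight x * ∏ (vertexWeight (C ─ x))
    ∏vertexWeight-─ = begin
      2 * ∏ (vertexWeight C)                      ≡⟨ cong (λ b → weight b * ∏ (vertexWeight C)) (─-self {p = C} {i = x}) ⟨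
      vertexWeight (C ─ x) x * ∏ (vertexWeight C) ≡⟨ ∏-update _ _ x (λ j j≢x → cong (weight′ j) (sym (─-other {p = C} j≢x))) ⟩
      vertexWeight C x * ∏ (vertexWeight (C ─ x)) ≡⟨ cong (λ b → weight b * ∏ (vertexWeight (C ─ x))) Cx ⟩
      insideWeight x * ∏ (vertexWeight (C ─ x))   ∎
      where
      open ≡-Reasoning
      weight′ : Fin n → Bool → ℕ
      weight′ v b = if b then insideWeight v else 2
      weight : Bool → ℕ
      weight = weight′ x

    edgeWeight-─-other : ∀ {f} → ¬ Endpoint x f → edgeWeight (C ─ x) f ≡ edgeWeight C f
    edgeWeight-─-other ¬xf =
      cong₂ pairWeight (─-other {p = C} (¬xf ∘ inj₁ ∘ sym)) (─-other {p = C} (¬xf ∘ inj₂ ∘ sym))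

    ∏edgeWeight-─ : ∀ {e y} → Link e x y →
      pairWeight false (C y) * ∏ (edgeWeight C) ≡ pairWeight true (C y) * ∏ (edgeWeight (C ─ x))
    ∏edgeWeight-─ {e} {y} l = begin
      pairWeight false (C y) * ∏ (edgeWeight C)         ≡⟨ cong (_* ∏ (edgeWeight C)) (removed l) ⟨
      edgeWeight (C ─ x) e * ∏ (edgeWeight C)           ≡⟨ ∏-update _ _ e (λ f f≢e →
                                                             sym (edgeWeight-─-other λ xf → f≢e (endpoint-unique xf (link-endpoint l)))) ⟩
      edgeWeight C e * ∏ (edgeWeight (C ─ x))           ≡⟨ cong (_* ∏ (edgeWeight (C ─ x))) (kept l) ⟩
      pairWeight true (C y) * ∏ (edgeWeight (C ─ x))    ∎
      where
      open ≡-Reasoning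
      removed : ∀ {y} → Link e x y → edgeWeight (C ─ x) e ≡ pairWeight false (C y)
      removed forward  rewrite ─-self {p = C} {i = x} | ─-other {p = C} (edge-ends-≢ e ∘ sym) = refl
      removed backward rewrite ─-self {p = C} {i = x} | ─-other {p = C} (edge-ends-≢ e) = pairWeight-comm _ false
      kept : ∀ {y} → Link e x y → edgeWeight C e ≡ pairWeight true (C y)
      kept forward rewrite Cx = refl
      kept backward rewrite Cx = pairWeight-comm _ true

    Φ-─-paired : ∀ {y} → Partners x y → C y ≡ true → Φ (C ─ x) ≤[ 3 / 4 ] Φ C
    Φ-─-paired (e , l) Cy = ≤[]-weaken {p = 6} {q = 8} ≤-refl (*≤* (≤-reflexive (Φ-ratio 2 1 3 8 {C} {C ─ x} vertices edges)))
      where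
      vertices : 2 * ∏ (vertexWeight C) ≡ 1 * ∏ (vertexWeight (C ─ x))
      vertices = trans ∏vertexWeight-─ (cong (_* ∏ (vertexWeight (C ─ x))) (insideWeight-matched (link-endpoint l)))
      edges : 3 * ∏ (edgeWeight C) ≡ 8 * ∏ (edgeWeight (C ─ x))
      edges = subst (λ b → pairWeight false b * ∏ (edgeWeight C) ≡ pairWeight true b * ∏ (edgeWeight (C ─ x)))
                    Cy (∏edgeWeight-─ l)

    Φ-─-unpaired : Unpaired C x → Φ (C ─ x) ≤[ 2 / 3 ] Φ C
    Φ-─-unpaired unpaired with matched? x
    ... | no unmatched = *≤* (≤-reflexive (Φ-ratio 2 3 1 1 {C} {C ─ x} vertices edges))
      where
      vertices : 2 * ∏ (vertexWeight C) ≡ 3 * ∏ (vertexWeight (C ─ x))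
      vertices = trans ∏vertexWeight-─ (cong (_* ∏ (vertexWeight (C ─ x))) (insideWeight-unmatched unmatched))
      edges : 1 * ∏ (edgeWeight C) ≡ 1 * ∏ (edgeWeight (C ─ x))
      edges = cong (1 *_) (∏-cong λ f → sym (edgeWeight-─-other λ xf → unmatched (f , xf)))
    ... | yes (e , xe) with endpoint-link xe
    ...   | y , l = *≤* (≤-reflexive (Φ-ratio 2 1 1 3 {C} {C ─ x} vertices edges))
      where
      vertices : 2 * ∏ (vertexWeight C) ≡ 1 * ∏ (vertexWeight (C ─ x))
      vertices = trans ∏vertexWeight-─ (cong (_* ∏ (vertexWeight (C ─ x))) (insideWeight-matched xe))
      edges : 1 * ∏ (edgeWeight C) ≡ 3 * ∏ (edgeWeight (C ─ x))
      edges = subst (λ b → pairWeight false b * ∏ (edgeWeight C) ≡ pairWeight true b * ∏ (edgeWeight (C ─ x)))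
                    (unpaired (e , l)) (∏edgeWeight-─ l)

  Φ-─ : ∀ {C x} → C x ≡ true → Φ (C ─ x) ≤[ 3 / 4 ] Φ C
  Φ-─ {C} {x} Cx with pairing C x
  ... | inj₁ (y , xy , Cy) = Φ-─-paired Cx xy Cy
  ... | inj₂ unpaired      = ≤[]-weaken (n≤1+n 8) (Φ-─-unpaired Cx unpaired)

  Φ-cong : ∀ {B C} → (∀ v → B v ≡ C v) → Φ B ≡ Φ C
  Φ-cong {B} {C} B≗C = cong₂ _*_
    (∏-cong λ v → cong (λ b → if b then insideWeight v else 2) (B≗C v))
    (∏-cong λ e → cong₂ pairWeight (B≗C (proj₁ (edge M e))) (B≗C (proj₂ (edge M e))))

  Φ-empty : ∀ {C} → (∀ v → C v ≡ false) → Φ C ≡ 2 ^ n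
  Φ-empty {C} empty = begin
    Φ C                                ≡⟨ Φ-cong {C} {λ _ → false} empty ⟩
    ∏ {n} (λ _ → 2) * ∏ {m} (λ _ → 1)  ≡⟨ cong₂ _*_ (∏-const {n} 2) (trans (∏-const {m} 1) (^-zeroˡ m)) ⟩
    2 ^ n * 1                          ≡⟨ *-identityʳ (2 ^ n) ⟩
    2 ^ n                              ∎
    where open ≡-Reasoning

  endpoint : Fin m ⊎ Fin m → Fin n
  endpoint (inj₁ e) = proj₁ (edge M e)
  endpoint (inj₂ e) = proj₂ (edge M e)

  endpoint-injective : ∀ s t → endpoint s ≡ endpoint t → s ≡ t
  endpoint-injective (inj₁ e) (inj₁ f) eq = cong inj₁ (endpoint-unique (inj₁ refl) (inj₁ eq))
  endpoint-injective (inj₂ e) (inj₂ f) eq = cong inj₂ (endpoint-unique (inj₂ refl) (inj₂ eq))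
  endpoint-injective (inj₁ e) (inj₂ f) eq with refl ← endpoint-unique (inj₁ refl) (inj₂ eq) =
    contradiction eq (edge-ends-≢ e)
  endpoint-injective (inj₂ e) (inj₁ f) eq with refl ← endpoint-unique (inj₂ refl) (inj₁ eq) =
    contradiction (sym eq) (edge-ends-≢ e)

  2m≤∣matched∣ : 2 * m ≤ ∣ matchedᵇ ∣
  2m≤∣matched∣ = subst (_≤ ∣ matchedᵇ ∣) (cong (m +_) (sym (+-identityʳ m)))
    (∣∣-injective (endpoint ∘ Fin.splitAt m) injective λ i → dec-true (matched? _) (matched (Fin.splitAt m i)))
    where
    injective : ∀ {i j} → endpoint (Fin.splitAt m i) ≡ endpoint (Fin.splitAt m j) → i ≡ j
    injective {i} {j} eq = trans (sym (Finₚ.join-splitAt m m i))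
      (trans (cong (Fin.join m m) (endpoint-injective (Fin.splitAt m i) (Fin.splitAt m j) eq)) (Finₚ.join-splitAt m m j))
    matched : ∀ s → ∃[ e ] Endpoint (endpoint s) e
    matched (inj₁ e) = e , inj₁ refl
    matched (inj₂ e) = e , inj₂ refl

  Φ-full : Φ full ≤ 2 ^ (3 * m) * 3 ^ (n ∸ 2 * m)
  Φ-full = begin
    ∏ (vertexWeight full) * ∏ (edgeWeight full) ≡⟨ cong₂ _*_ (∏-if matchedᵇ 3) (∏-const {m} 8) ⟩
    3 ^ ∣ not ∘ matchedᵇ ∣ * 8 ^ m              ≤⟨ *-monoˡ-≤ (8 ^ m) (^-monoʳ-≤ 3 unmatched≤) ⟩
    3 ^ (n ∸ 2 * m) * 8 ^ m                     ≡⟨ *-comm (3 ^ (n ∸ 2 * m)) (8 ^ m) ⟩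
    8 ^ m * 3 ^ (n ∸ 2 * m)                     ≡⟨ cong (_* 3 ^ (n ∸ 2 * m)) (^-*-assoc 2 3 m) ⟩
    2 ^ (3 * m) * 3 ^ (n ∸ 2 * m)               ∎
    where
    open ≤-Reasoning
    unmatched≤ : ∣ not ∘ matchedᵇ ∣ ≤ n ∸ 2 * m
    unmatched≤ = begin
      ∣ not ∘ matchedᵇ ∣                          ≡⟨ m+n∸m≡n ∣ matchedᵇ ∣ _ ⟨
      ∣ matchedᵇ ∣ + ∣ not ∘ matchedᵇ ∣ ∸ ∣ matchedᵇ ∣ ≡⟨ cong (_∸ ∣ matchedᵇ ∣) (∣∣-complement matchedᵇ) ⟩
      n ∸ ∣ matchedᵇ ∣                            ≤⟨ ∸-monoʳ-≤ n 2m≤∣matched∣ ⟩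
      n ∸ 2 * m                                   ∎

  infix 4 _<ˢ_
  _<ˢ_ : VertexSet → VertexSet → Set
  B <ˢ C = ∣ B ∣ < ∣ C ∣

  <ˢ-wellFounded : WellFounded _<ˢ_
  <ˢ-wellFounded = On.wellFounded (∣_∣ {n}) <-wellFounded

  open WF.All <ˢ-wellFounded 0ℓ using () renaming (wfRec to <ˢ-rec)

  ─-<ˢ : ∀ {C x} → C x ≡ true → C ─ x <ˢ C
  ─-<ˢ {C} Cx = ≤-reflexive (sym (∣─∣ {p = C} Cx))

  Φ-mono : ∀ {B C} → B ⊆ C → Φ B ≤ Φ C
  Φ-mono {B} {C} = <ˢ-rec (λ C → B ⊆ C → Φ B ≤ Φ C) step C
    where
    step : ∀ C → WfRec _<ˢ_ (λ C → B ⊆ C → Φ B ≤ Φ C) C → B ⊆ C → Φ B ≤ Φ C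
    step C rec B⊆C with Finₚ.any? (λ v → (C v Boolₚ.≟ true) ×-dec (B v Boolₚ.≟ false))
    ... | yes (v , Cv , Bv) = ≤-trans (rec (─-<ˢ Cv) B⊆C─v) (≤[]⇒≤ (n≤1+n 3) (Φ-─ Cv))
      where
      B⊆C─v : B ⊆ C ─ v
      B⊆C─v Bu = ∈-─⁺ {p = C} (B⊆C Bu) λ { refl → contradiction (trans (sym Bu) Bv) λ () }
    ... | no ∄v = ≤-reflexive (Φ-cong B≗C)
      where
      B≗C : ∀ v → B v ≡ C v
      B≗C v with B v in Bv | C v in Cv
      ... | true  | true  = refl
      ... | false | false = refl
      ... | true  | false = contradiction (trans (sym (B⊆C Bv)) Cv) λ ()
      ... | false | true  = contradiction (v , Cv , Bv) ∄v

  Φ-∖ : ∀ {C} R → Unique R → All (λ r → C r ≡ true) R → Φ (C ∖ R) ≤[ 3 ^ length R / 4 ^ length R ] Φ C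
  Φ-∖ []      []            []         = *≤* ≤-refl
  Φ-∖ (r ∷ R) (r∉R ∷ uniq) (Cr ∷ CR) = ≤[]-trans (Φ-─ (∈-∖⁺ Cr r∉R)) (Φ-∖ R uniq CR)

  unpaired-∖ : ∀ {C x y} R → Partners x y → y ∈ˡ R → Unpaired (C ∖ R) x
  unpaired-∖ {C} R xy y∈R xz rewrite partners-unique xz xy = ∉-∖ {p = C} y∈R

  unpaired-∖′ : ∀ {C x} R → Unpaired C x → Unpaired (C ∖ R) x
  unpaired-∖′ {C} R unpaired {z} xz with (C ∖ R) z in eq
  ... | false = refl
  ... | true  = contradiction (trans (sym (proj₁ (∈-∖⁻ {p = C} {R = R} eq))) (unpaired xz)) λ ()

  Φ-pair : ∀ {C x y} → C x ≡ true → Partners x y → C y ≡ true → Φ (C ∖ (y ∷ x ∷ [])) ≤[ 6 / 12 ] Φ C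
  Φ-pair {C} {x} Cx xy Cy = ≤[]-trans
    (Φ-─-unpaired (∈-∖⁺ {p = C} Cy (partners-≢ (partners-sym xy) ∷ []))
                  (unpaired-∖ {C} (x ∷ []) (partners-sym xy) (here refl)))
    (Φ-─ Cx)

  Independent : VSet n → Set
  Independent S = ∀ u v → u ∈ S → v ∈ S → adj Γ u v ≡ false

  record IsMIS (W : VertexSet) (S : VSet n) : Set where
    constructor isMIS
    field
      ⊆W          : ∀ v → v ∈ S → W v ≡ true
      independent : Independent S
      dominating  : ∀ v → W v ≡ true → lookup S v ≡ false → ∃[ u ] (u ∈ S × adj Γ v u ≡ true)
  open IsMIS

  _∈?_ : ∀ v (S : VSet n) → Dec (v ∈ S)
  v ∈? S = lookup S v Boolₚ.≟ true

  isMIS? : ∀ W → Decidable (IsMIS W)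
  isMIS? W S = Dec.map′ (λ (s , i , d) → isMIS s i d) (λ I → ⊆W I , independent I , dominating I)
    (Finₚ.all? (λ v → (v ∈? S) →-dec (W v Boolₚ.≟ true)) ×-dec
     Finₚ.all? (λ u → Finₚ.all? λ v → (u ∈? S) →-dec ((v ∈? S) →-dec (adj Γ u v Boolₚ.≟ false))) ×-dec
     Finₚ.all? (λ v → (W v Boolₚ.≟ true) →-dec ((lookup S v Boolₚ.≟ false) →-dec
                       Finₚ.any? (λ u → (u ∈? S) ×-dec (adj Γ v u Boolₚ.≟ true)))))

  #MIS : VertexSet → ℕ
  #MIS W = count (isMIS? W) (allSubsets n)

  independentᵇ⇒ : ∀ {S} → T (independentᵇ Γ S) → Independent S
  independentᵇ⇒ {S} t u v u∈S v∈S = Equivalence.to Boolₚ.T-not-≡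
    (subst₂ (λ a b → T (not (a ∧ b ∧ adj Γ u v))) u∈S v∈S (allV⁻ {p = apart u} (allV⁻ {p = allV ∘ apart} t u) v))
    where
    apart : Fin n → Fin n → Bool
    apart u v = not (u ∈ᵇ S ∧ v ∈ᵇ S ∧ adj Γ u v)

  ⇒independentᵇ : ∀ {S} → Independent S → T (independentᵇ Γ S)
  ⇒independentᵇ {S} ind = allV⁺ λ u → allV⁺ λ v → pair u v
    where
    pair : ∀ u v → T (not (u ∈ᵇ S ∧ v ∈ᵇ S ∧ adj Γ u v))
    pair u v with lookup S u in Su | lookup S v in Sv
    ... | false | _     = tt
    ... | true  | false = tt
    ... | true  | true  rewrite ind u v Su Sv = tt

  maximal⇒IsMIS : ∀ {S} → T (maximalIndependentᵇ Γ S) → IsMIS full S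
  maximal⇒IsMIS {S} t = isMIS (λ _ _ → refl) (independentᵇ⇒ {S} (T-∧ˡ t)) dominating′
    where
    dominating′ : ∀ v → full v ≡ true → lookup S v ≡ false → ∃[ u ] (u ∈ S × adj Γ v u ≡ true)
    dominating′ v _ v∉S with Finₚ.any? (λ u → (u ∈? S) ×-dec (adj Γ v u Boolₚ.≟ true))
    ... | yes found = found
    ... | no ∄u = contradiction (trans (sym v∈S) v∉S) λ ()
      where
      S′ = S [ v ]≔ true
      ∈S′⁻ : ∀ {u} → u ∈ S′ → u ≢ v → u ∈ S
      ∈S′⁻ u∈S′ u≢v = trans (sym (lookup∘update′ u≢v S true)) u∈S′
      S′-independent : ∀ u w → u ∈ S′ → w ∈ S′ → adj Γ u w ≡ false
      S′-independent u w u∈S′ w∈S′ with u Finₚ.≟ v | w Finₚ.≟ v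
      ... | yes refl | yes refl = irrefl Γ u
      ... | yes refl | no w≢v  = Boolₚ.¬-not λ uw → ∄u (w , ∈S′⁻ w∈S′ w≢v , uw)
      ... | no u≢v  | yes refl = Boolₚ.¬-not λ uw → ∄u (u , ∈S′⁻ u∈S′ u≢v , adj-sym uw)
      ... | no u≢v  | no w≢v   = independentᵇ⇒ {S} (T-∧ˡ t) u w (∈S′⁻ u∈S′ u≢v) (∈S′⁻ w∈S′ w≢v)
      S⊆S′ : ∀ u → T (not (u ∈ᵇ S) ∨ u ∈ᵇ S′)
      S⊆S′ u with u Finₚ.≟ v
      ... | yes refl rewrite lookup∘update u S true = subst T (sym (Boolₚ.∨-zeroʳ (not (lookup S u)))) tt
      ... | no u≢v  rewrite lookup∘update′ u≢v S true = subst T (sym (Boolₚ.∨-inverseˡ (lookup S u))) tt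
      maximal : T (not (independentᵇ Γ S′ ∧ (S ⊆ᵇ S′)) ∨ (S′ ==ᵇ S))
      maximal = All.lookup (Allₚ.all⁺ _ (allSubsets n) (T-∧ʳ t)) (∈-allSubsets S′)
      S′⊆S : T (S′ ⊆ᵇ S)
      S′⊆S = T-∧ˡ (subst₂ (λ a b → T (not (a ∧ b) ∨ (S′ ==ᵇ S)))
                          (T⇒≡ (⇒independentᵇ {S′} S′-independent)) (T⇒≡ (allV⁺ S⊆S′)) maximal)
      v∈S : v ∈ S
      v∈S = T⇒≡ (subst (λ b → T (not b ∨ lookup S v)) (lookup∘update v S true) (allV⁻ S′⊆S v))

  mis≤#MIS : mis Γ ≤ #MIS full
  mis≤#MIS = count-mono (T? ∘ maximalIndependentᵇ Γ) (isMIS? full) maximal⇒IsMIS (allSubsets n)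

  Avoids : List (Fin n) → VSet n → Set
  Avoids D S = All (λ d → lookup S d ≡ false) D

  avoids? : ∀ D → Decidable (Avoids D)
  avoids? D S = All.all? (λ d → lookup S d Boolₚ.≟ false) D

  #MIS-avoiding : VertexSet → List (Fin n) → ℕ
  #MIS-avoiding W D = count (λ S → isMIS? W S ×-dec avoids? D S) (allSubsets n)

  infixl 6 _─N[_]
  _─N[_] : VertexSet → Fin n → VertexSet
  C ─N[ c ] = (λ v → C v ∧ not (adj Γ c v)) ─ c

  ∈-─N⁺ : ∀ {C c v} → C v ≡ true → v ≢ c → adj Γ c v ≡ false → (C ─N[ c ]) v ≡ true
  ∈-─N⁺ {C} {c} Cv v≢c cv rewrite ─-other {p = λ u → C u ∧ not (adj Γ c u)} v≢c | Cv | cv = refl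

  ∈-─N⁻ : ∀ {C c v} → (C ─N[ c ]) v ≡ true → C v ≡ true × v ≢ c × adj Γ c v ≡ false
  ∈-─N⁻ {C} {c} {v} h with ∈-─⁻ {p = λ u → C u ∧ not (adj Γ c u)} h
  ... | h′ , v≢c with C v | adj Γ c v
  ... | true | false = refl , v≢c , refl

  Nbrs⊆ : VertexSet → Fin n → List (Fin n) → Set
  Nbrs⊆ C x L = ∀ {u} → adj Γ x u ≡ true → C u ≡ true → u ∈ˡ L

  avoids⇒∉ : ∀ {D S v} → Avoids D S → v ∈ S → All (v ≢_) D
  avoids⇒∉ avoids v∈S = All.map (λ Sd → λ { refl → contradiction (trans (sym v∈S) Sd) λ () }) avoids

  IsMIS-─N : ∀ {W S D c} → IsMIS W S → Avoids D S → c ∈ S → IsMIS ((W ∖ D) ─N[ c ]) (S [ c ]≔ false)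
  IsMIS-─N {W} {S} {D} {c} I avoids c∈S = isMIS ⊆B indep dom
    where
    S′ = S [ c ]≔ false
    kept : ∀ {v} → v ≢ c → lookup S′ v ≡ lookup S v
    kept v≢c = lookup∘update′ v≢c S false
    ∈S′⁻ : ∀ {v} → v ∈ S′ → v ∈ S × v ≢ c
    ∈S′⁻ {v} v∈S′ with v Finₚ.≟ c
    ... | yes refl = contradiction (trans (sym v∈S′) (lookup∘update c S false)) λ ()
    ... | no v≢c   = trans (sym (kept v≢c)) v∈S′ , v≢c
    ⊆B : ∀ v → v ∈ S′ → ((W ∖ D) ─N[ c ]) v ≡ true
    ⊆B v v∈S′ with ∈S′⁻ v∈S′
    ... | v∈S , v≢c =
      ∈-─N⁺ {W ∖ D} (∈-∖⁺ {p = W} (⊆W I v v∈S) (avoids⇒∉ {S = S} avoids v∈S)) v≢c (independent I c v c∈S v∈S)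
    indep : ∀ u v → u ∈ S′ → v ∈ S′ → adj Γ u v ≡ false
    indep u v u∈S′ v∈S′ = independent I u v (proj₁ (∈S′⁻ u∈S′)) (proj₁ (∈S′⁻ v∈S′))
    dom : ∀ v → ((W ∖ D) ─N[ c ]) v ≡ true → lookup S′ v ≡ false → ∃[ u ] (u ∈ S′ × adj Γ v u ≡ true)
    dom v Bv v∉S′ with ∈-─N⁻ {W ∖ D} Bv
    ... | WDv , v≢c , cv with dominating I v (proj₁ (∈-∖⁻ {p = W} {R = D} WDv)) (trans (sym (kept v≢c)) v∉S′)
    ... | u , u∈S , vu = u , trans (kept u≢c) u∈S , vu
      where
      u≢c : u ≢ c
      u≢c refl = contradiction (trans (Graph.sym Γ c v) vu) (λ cv′ → contradiction (trans (sym cv′) cv) λ ())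

  IsMIS-∖ : ∀ {W S D} → IsMIS W S → Avoids D S → IsMIS (W ∖ D) S
  IsMIS-∖ {W} {S} {D} I avoids = isMIS
    (λ v v∈S → ∈-∖⁺ {p = W} (⊆W I v v∈S) (avoids⇒∉ {S = S} avoids v∈S))
    (independent I)
    (λ v WDv → dominating I v (proj₁ (∈-∖⁻ {p = W} {R = D} WDv)))

  IsMIS-meets : ∀ {W S D v} → IsMIS W S → W v ≡ true → v ∈ˡ D → Nbrs⊆ W v D → ¬ Avoids D S
  IsMIS-meets {W} {S} {D} {v} I Wv v∈D N⊆D avoids
    with u , u∈S , vu ← dominating I v Wv (All.lookup avoids v∈D)
    = contradiction (trans (sym u∈S) (All.lookup avoids (N⊆D vu (⊆W I u u∈S)))) λ ()

  #MIS≤#MIS-avoiding[] : ∀ W → #MIS W ≤ #MIS-avoiding W []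
  #MIS≤#MIS-avoiding[] W = count-mono (isMIS? W) (λ S → isMIS? W S ×-dec avoids? [] S) (_, []) (allSubsets n)

  #MIS-avoiding-─N : ∀ W D c → #MIS-avoiding W D ≤ #MIS ((W ∖ D) ─N[ c ]) + #MIS-avoiding W (c ∷ D)
  #MIS-avoiding-─N W D c = ≤-trans (count-split P? (c ∈?_) (allSubsets n)) (+-mono-≤
    (count-allSubsets-clear (λ S → P? S ×-dec (c ∈? S)) (isMIS? ((W ∖ D) ─N[ c ])) c
      λ ((I , avoids) , c∈S) → c∈S , IsMIS-─N I avoids c∈S)
    (count-mono (λ S → P? S ×-dec ¬? (c ∈? S)) (λ S → isMIS? W S ×-dec avoids? (c ∷ D) S)
      (λ ((I , avoids) , c∉S) → I , Boolₚ.¬-not c∉S ∷ avoids) (allSubsets n)))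
    where
    P? = λ S → isMIS? W S ×-dec avoids? D S

  #MIS-avoiding≤#MIS-∖ : ∀ W D → #MIS-avoiding W D ≤ #MIS (W ∖ D)
  #MIS-avoiding≤#MIS-∖ W D = count-mono (λ S → isMIS? W S ×-dec avoids? D S) (isMIS? (W ∖ D))
    (λ (I , avoids) → IsMIS-∖ I avoids) (allSubsets n)

  #MIS-avoiding-covered : ∀ {W D v} → W v ≡ true → v ∈ˡ D → Nbrs⊆ W v D → #MIS-avoiding W D ≡ 0
  #MIS-avoiding-covered {W} {D} Wv v∈D N⊆D =
    count-none (λ S → isMIS? W S ×-dec avoids? D S) (λ (I , avoids) → IsMIS-meets I Wv v∈D N⊆D avoids) (allSubsets n)

  #MIS-empty : ∀ {W} → (∀ v → W v ≡ false) → #MIS W ≤ 1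
  #MIS-empty {W} empty = count-allSubsets-≤1 (isMIS? W)
    λ I i → Boolₚ.¬-not λ i∈S → contradiction (trans (sym (⊆W I i i∈S)) (empty i)) λ ()

  -- Branching

  nbrs : VertexSet → Fin n → List (Fin n)
  nbrs C x = filterᵇ (λ u → adj Γ x u ∧ C u) (allFin n)

  Nbr : VertexSet → List (Fin n) → Fin n → Fin n → Set
  Nbr C R x u = adj Γ x u ≡ true × C u ≡ true × All (u ≢_) (R ++ x ∷ [])

  record Nbhd (C : VertexSet) (R : List (Fin n)) (x : Fin n) : Set where
    constructor nbhd
    field
      list     : List (Fin n)
      sound    : All (Nbr C R x) list
      distinct : Unique list
      complete : Nbrs⊆ C x (R ++ list)

  nbhd-of : ∀ C R x → Nbhd C R x
  nbhd-of C R x = nbhd (nbrs (C ∖ R) x)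
    (All.tabulate λ u∈ → sound (proj₂ (∈-filter⁻ (T? ∘ p) {xs = allFin n} u∈)))
    (Uniqueₚ.filter⁺ (T? ∘ p) (Uniqueₚ.allFin⁺ n))
    complete
    where
    p : Fin n → Bool
    p u = adj Γ x u ∧ (C ∖ R) u
    sound : ∀ {u} → T (p u) → Nbr C R x u
    sound {u} Tpu with adj Γ x u in xu | (C ∖ R) u in CRu
    ... | true | true = let Cu , u∉R = ∈-∖⁻ {p = C} {R = R} CRu in
      refl , Cu , Allₚ.++⁺ u∉R (adj⇒≢ xu ∘ sym ∷ [])
    complete : Nbrs⊆ C x (R ++ nbrs (C ∖ R) x)
    complete {u} xu Cu with Any.any? (u Finₚ.≟_) R
    ... | yes u∈R = ∈-++⁺ˡ u∈R
    ... | no u∉R  = ∈-++⁺ʳ R (∈-filter⁺ (T? ∘ p) (∈-allFin u)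
                      (subst T (sym (cong₂ _∧_ xu (∈-∖⁺ {p = C} Cu (Allₚ.¬Any⇒All¬ R u∉R)))) tt))

  Nbr-mono : ∀ {B C R x u} → B ⊆ C → Nbr B R x u → Nbr C R x u
  Nbr-mono B⊆C (xu , Bu , u∉R) = xu , B⊆C Bu , u∉R

  Nbr⇒∈-∖ : ∀ {C x L} R → All (Nbr C R x) L → All (λ u → (C ∖ (R ++ x ∷ [])) u ≡ true) L
  Nbr⇒∈-∖ {C} R = All.map λ (_ , Cu , u∉Rx) → ∈-∖⁺ {p = C} Cu u∉Rx

  partner-≢ : ∀ {x y a a′} → Partners x y → Partners a a′ → a ≢ x → a ≢ y → a′ ≢ x
  partner-≢ xy aa′ a≢x a≢y refl = a≢y (partners-unique (partners-sym aa′) xy)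

  Nbrs⊆-weaken : ∀ {C x L L′} → All (_∈ˡ L′) L → Nbrs⊆ C x L → Nbrs⊆ C x L′
  Nbrs⊆-weaken L⊆L′ N⊆L xu Cu = All.lookup L⊆L′ (N⊆L xu Cu)

  data Excluded (c : Fin n) (D : List (Fin n)) : Fin n → Set where
    centre  : Excluded c D c
    nbr     : ∀ {r} → adj Γ c r ≡ true → Excluded c D r
    earlier : ∀ {r} → r ∈ˡ D → Excluded c D r

  excluded : ∀ {W c D r} → Excluded c D r → ((W ∖ D) ─N[ c ]) r ≡ false
  excluded {W} {c} {D} {r} ex with ((W ∖ D) ─N[ c ]) r in eq
  ... | false = refl
  ... | true with ∈-─N⁻ {W ∖ D} eq | ex
  ...   | _ , r≢c , _  | centre    = contradiction refl r≢c
  ...   | _ , _ , cr   | nbr cr′   = contradiction (trans (sym cr′) cr) λ ()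
  ...   | WDr , _ , _  | earlier r∈D = contradiction (trans (sym WDr) (∉-∖ {p = W} r∈D)) λ ()

  ─N-⊆-∖ : ∀ {W c D R} → All (Excluded c D) R → (W ∖ D) ─N[ c ] ⊆ W ∖ R
  ─N-⊆-∖ {W} {c} {D} excl {v} Bv with ∈-─N⁻ {W ∖ D} Bv
  ... | WDv , _ = ∈-∖⁺ {p = W} (proj₁ (∈-∖⁻ {p = W} {R = D} WDv))
                    (All.map (λ ex → λ { refl → contradiction (trans (sym Bv) (excluded {W} ex)) λ () }) excl)

  ⊂⇒<ˢ : ∀ {B C c} → B ⊆ C → C c ≡ true → B c ≡ false → B <ˢ C
  ⊂⇒<ˢ {B} {C} {c} B⊆C Cc Bc = ≤-trans (s≤s (∣∣-mono {p = B} {q = C ─ c} B⊆C─c)) (─-<ˢ Cc)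
    where
    B⊆C─c : ∀ v → B v ≡ true → (C ─ c) v ≡ true
    B⊆C─c v Bv = ∈-─⁺ {p = C} (B⊆C Bv) λ { refl → contradiction (trans (sym Bv) Bc) λ () }

  Bound : VertexSet → Set
  Bound W = #MIS W * 2 ^ n ≤ Φ W

  module Branching (W : VertexSet) (IH : ∀ {B} → B <ˢ W → Bound B) where

    Estimate : List (Fin n) → ℕ → ℕ → Set
    Estimate D p q = #MIS-avoiding W D * 2 ^ n ≤[ p / q ] Φ W

    branch : ∀ {c D R p q p′ q′} → W c ≡ true → All (Excluded c D) R → Φ (W ∖ R) ≤[ p / q ] Φ W →
             Estimate (c ∷ D) p′ q′ → Estimate D (p * q′ + p′ * q) (q * q′)
    branch {c} {D} {R} Wc excl ΦR rest = ≤-≤[]-trans split (≤[]-+ (≤-≤[]-trans B-bound ΦR) rest)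
      where
      B = (W ∖ D) ─N[ c ]
      split : #MIS-avoiding W D * 2 ^ n ≤ #MIS B * 2 ^ n + #MIS-avoiding W (c ∷ D) * 2 ^ n
      split = ≤-trans (*-monoˡ-≤ (2 ^ n) (#MIS-avoiding-─N W D c))
                      (≤-reflexive (*-distribʳ-+ (2 ^ n) (#MIS B) (#MIS-avoiding W (c ∷ D))))
      B<W : B <ˢ W
      B<W = ⊂⇒<ˢ (λ Bv → proj₁ (∈-∖⁻ {p = W} {R = D} (proj₁ (∈-─N⁻ {W ∖ D} Bv)))) Wc (excluded {W} {c} {D} centre)
      B-bound : #MIS B * 2 ^ n ≤ Φ (W ∖ R)
      B-bound = ≤-trans (IH B<W) (Φ-mono (─N-⊆-∖ {W} excl))

    closed : ∀ {D v} → W v ≡ true → v ∈ˡ D → Nbrs⊆ W v D → Estimate D 0 1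
    closed {D} Wv v∈D N⊆D rewrite #MIS-avoiding-covered {W} {D} Wv v∈D N⊆D = *≤* z≤n

    remaining : ∀ {D v p q} → W v ≡ true → v ∈ˡ D → Φ (W ∖ D) ≤[ p / q ] Φ W → Estimate D p q
    remaining {D} Wv v∈D ΦD = ≤-≤[]-trans
      (≤-trans (*-monoˡ-≤ (2 ^ n) (#MIS-avoiding≤#MIS-∖ W D))
               (IH (⊂⇒<ˢ (λ WDv → proj₁ (∈-∖⁻ {p = W} {R = D} WDv)) Wv (∉-∖ {p = W} v∈D))))
      ΦD

    -- The branch weights must add up to at most 1; the side condition is decided by evaluation.
    conclude : ∀ {p q} .{{_ : NonZero q}} → Estimate [] p q → {T (p ≤ᵇ q)} → Bound W
    conclude {p} {q} est {p≤q} =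
      ≤[]⇒≤ (≤ᵇ⇒≤ p q p≤q) (≤-≤[]-trans (*-monoˡ-≤ (2 ^ n) (#MIS≤#MIS-avoiding[] W)) est)

    ∈W∖ : ∀ {u R} → W u ≡ true → All (u ≢_) R → (W ∖ R) u ≡ true
    ∈W∖ = ∈-∖⁺ {p = W}

    rule-isolated : ∀ {v} → W v ≡ true → Unpaired W v → Nbrs⊆ W v [] → Bound W
    rule-isolated Wv unv N⊆ = conclude
      (branch Wv (centre ∷ []) (Φ-─-unpaired Wv unv)
      (closed Wv ∈₀ (Nbrs⊆-weaken [] N⊆)))

    rule-pendant : ∀ {v a} → W v ≡ true → Unpaired W v → Nbr W [] v a → Nbrs⊆ W v (a ∷ []) → Bound W
    rule-pendant {v} {a} Wv unv (va , Wa , a≢v ∷ []) N⊆ = conclude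
      (branch Wv (nbr va ∷ centre ∷ []) Φva
      (branch Wa (centre ∷ earlier ∈₀ ∷ []) Φva
      (closed Wv ∈₁ (Nbrs⊆-weaken (∈₀ ∷ []) N⊆))))
      where
      Φva : Φ (W ∖ (a ∷ v ∷ [])) ≤[ 6 / 12 ] Φ W
      Φva = ≤[]-trans (Φ-─ (∈W∖ Wa (a≢v ∷ []))) (Φ-─-unpaired Wv unv)

    rule-unpaired-deg2 : ∀ {v a b r} → W v ≡ true → Unpaired W v → Nbrs⊆ W v (a ∷ b ∷ []) →
                         Nbr W [] v a → Unpaired W a → Nbr W [] v b → Unpaired W b → a ≢ b → Nbr W (v ∷ []) a r → Bound W
    rule-unpaired-deg2 {v} {a} {b} {r} Wv unv N⊆ (va , Wa , a≢v ∷ []) una (vb , Wb , b≢v ∷ []) unb a≢b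
                       (ar , Wr , r≢v ∷ r≢a ∷ []) = conclude
      (branch Wv (nbr vb ∷ nbr va ∷ centre ∷ []) Φvab
      (branch Wa (nbr ar ∷ earlier ∈₀ ∷ centre ∷ []) Φavr
      (branch Wb (earlier ∈₀ ∷ earlier ∈₁ ∷ centre ∷ []) Φbva
      (closed Wv ∈₂ (Nbrs⊆-weaken (∈₁ ∷ ∈₀ ∷ []) N⊆)))))
      where
      Φvab : Φ (W ∖ (b ∷ a ∷ v ∷ [])) ≤[ 8 / 27 ] Φ W
      Φvab = ≤[]-trans (Φ-─-unpaired (∈W∖ Wb (a≢b ∘ sym ∷ b≢v ∷ [])) (unpaired-∖′ (a ∷ v ∷ []) unb))
            (≤[]-trans (Φ-─-unpaired (∈W∖ Wa (a≢v ∷ [])) (unpaired-∖′ (v ∷ []) una))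
            (Φ-─-unpaired Wv unv))
      Φavr : Φ (W ∖ (r ∷ v ∷ a ∷ [])) ≤[ 12 / 36 ] Φ W
      Φavr = ≤[]-trans (Φ-─ (∈W∖ Wr (r≢v ∷ r≢a ∷ [])))
            (≤[]-trans (Φ-─-unpaired (∈W∖ Wv (a≢v ∘ sym ∷ [])) (unpaired-∖′ (a ∷ []) unv))
            (Φ-─-unpaired Wa una))
      Φbva : Φ (W ∖ (a ∷ v ∷ b ∷ [])) ≤[ 8 / 27 ] Φ W
      Φbva = ≤[]-trans (Φ-─-unpaired (∈W∖ Wa (a≢v ∷ a≢b ∷ [])) (unpaired-∖′ (v ∷ b ∷ []) una))
            (≤[]-trans (Φ-─-unpaired (∈W∖ Wv (b≢v ∘ sym ∷ [])) (unpaired-∖′ (b ∷ []) unv))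
            (Φ-─-unpaired Wb unb))

    rule-unpaired-deg3 : ∀ {v a b c} → W v ≡ true → Unpaired W v →
                         All (Nbr W [] v) (a ∷ b ∷ c ∷ []) → Unique (a ∷ b ∷ c ∷ []) → Bound W
    rule-unpaired-deg3 Wv unv abc@((va , _) ∷ (vb , _) ∷ (vc , _) ∷ []) distinct = conclude
      (branch Wv (nbr va ∷ nbr vb ∷ nbr vc ∷ centre ∷ [])
        (≤[]-trans (Φ-∖ _ distinct (Nbr⇒∈-∖ [] abc)) (Φ-─-unpaired Wv unv))
      (remaining Wv ∈₀ (Φ-─-unpaired Wv unv)))

    module _ {x y : Fin n} (Wx : W x ≡ true) (xy : Partners x y) (Wy : W y ≡ true) where

      Φxy : Φ (W ∖ (y ∷ x ∷ [])) ≤[ 6 / 12 ] Φ W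
      Φxy = Φ-pair Wx xy Wy

      Φxy─ : ∀ {u} → W u ≡ true → u ≢ y → u ≢ x → Φ (W ∖ (u ∷ y ∷ x ∷ [])) ≤[ 18 / 48 ] Φ W
      Φxy─ Wu u≢y u≢x = ≤[]-trans (Φ-─ (∈W∖ Wu (u≢y ∷ u≢x ∷ []))) Φxy

      Φxy─-partner : ∀ {a a′} → Nbr W (y ∷ []) x a → Partners a a′ → W a′ ≡ true →
                     Φ (W ∖ (a′ ∷ a ∷ y ∷ x ∷ [])) ≤[ 36 / 144 ] Φ W
      Φxy─-partner {a} (_ , Wa , a≢y ∷ a≢x ∷ []) aa′ Wa′ = ≤[]-trans
        (Φ-─-unpaired (∈W∖ Wa′ (partners-≢ (partners-sym aa′) ∷ partner-≢ (partners-sym xy) aa′ a≢y a≢x ∷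
                                partner-≢ xy aa′ a≢x a≢y ∷ []))
                      (unpaired-∖ {W} (a ∷ y ∷ x ∷ []) (partners-sym aa′) ∈₀))
        (Φxy─ Wa a≢y a≢x)

      rule-paired-pendant : Nbrs⊆ W x (y ∷ []) → Bound W
      rule-paired-pendant N⊆ = conclude
        (branch Wx (nbr (partners-adj xy) ∷ centre ∷ []) Φxy
        (branch Wy (centre ∷ earlier ∈₀ ∷ []) Φxy
        (closed Wx ∈₁ (Nbrs⊆-weaken (∈₀ ∷ []) N⊆))))

      rule-paired-deg2-paired : ∀ {a a′ c} → Nbrs⊆ W x (y ∷ a ∷ []) → Nbr W (y ∷ []) x a → Partners a a′ → W a′ ≡ true →
                                Nbr W (x ∷ []) y c → Bound W
      rule-paired-deg2-paired N⊆ xa@(x~a , Wa , a≢y ∷ a≢x ∷ []) aa′ Wa′ (y~c , Wc , c≢x ∷ c≢y ∷ []) = conclude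
        (branch Wx (nbr x~a ∷ nbr (partners-adj xy) ∷ centre ∷ []) (Φxy─ Wa a≢y a≢x)
        (branch Wy (nbr y~c ∷ centre ∷ earlier ∈₀ ∷ []) (Φxy─ Wc c≢y c≢x)
        (branch Wa (nbr (partners-adj aa′) ∷ centre ∷ earlier ∈₀ ∷ earlier ∈₁ ∷ []) (Φxy─-partner xa aa′ Wa′)
        (closed Wx ∈₂ (Nbrs⊆-weaken (∈₁ ∷ ∈₀ ∷ []) N⊆)))))

      rule-paired-deg2-unpaired : ∀ {a b c} → Nbrs⊆ W x (y ∷ a ∷ []) → Nbr W (y ∷ []) x a → Unpaired W a →
                                  Nbr W (y ∷ x ∷ []) a b → Nbr W (x ∷ []) y c → Bound W
      rule-paired-deg2-unpaired {a} {b} N⊆ (x~a , Wa , a≢y ∷ a≢x ∷ []) una (a~b , Wb , b≢y ∷ b≢x ∷ b≢a ∷ [])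
                                (y~c , Wc , c≢x ∷ c≢y ∷ []) = conclude
        (branch Wx (nbr x~a ∷ nbr (partners-adj xy) ∷ centre ∷ []) Φxya
        (branch Wy (nbr y~c ∷ centre ∷ earlier ∈₀ ∷ []) (Φxy─ Wc c≢y c≢x)
        (branch Wa (nbr a~b ∷ centre ∷ earlier ∈₀ ∷ earlier ∈₁ ∷ []) Φxyab
        (closed Wx ∈₂ (Nbrs⊆-weaken (∈₁ ∷ ∈₀ ∷ []) N⊆)))))
        where
        Φxya : Φ (W ∖ (a ∷ y ∷ x ∷ [])) ≤[ 12 / 36 ] Φ W
        Φxya = ≤[]-trans (Φ-─-unpaired (∈W∖ Wa (a≢y ∷ a≢x ∷ [])) (unpaired-∖′ (y ∷ x ∷ []) una)) Φxy
        Φxyab : Φ (W ∖ (b ∷ a ∷ y ∷ x ∷ [])) ≤[ 36 / 144 ] Φ W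
        Φxyab = ≤[]-trans (Φ-─ (∈W∖ Wb (b≢a ∷ b≢y ∷ b≢x ∷ []))) Φxya

      rule-paired-deg2-triangle : ∀ {a} → Nbrs⊆ W x (y ∷ a ∷ []) → Nbr W (y ∷ []) x a → Unpaired W a →
                                  adj Γ y a ≡ true → Bound W
      rule-paired-deg2-triangle {a} N⊆ (x~a , Wa , a≢y ∷ a≢x ∷ []) una y~a = conclude
        (branch Wx (nbr x~a ∷ nbr (partners-adj xy) ∷ centre ∷ []) Φxya
        (branch Wy (nbr y~a ∷ centre ∷ earlier ∈₀ ∷ []) Φxya
        (branch Wa (centre ∷ earlier ∈₀ ∷ earlier ∈₁ ∷ []) Φxya
        (closed Wx ∈₂ (Nbrs⊆-weaken (∈₁ ∷ ∈₀ ∷ []) N⊆)))))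
        where
        Φxya : Φ (W ∖ (a ∷ y ∷ x ∷ [])) ≤[ 12 / 36 ] Φ W
        Φxya = ≤[]-trans (Φ-─-unpaired (∈W∖ Wa (a≢y ∷ a≢x ∷ [])) (unpaired-∖′ (y ∷ x ∷ []) una)) Φxy

      rule-paired-deg3-cheap : ∀ {a b} → adj Γ x a ≡ true → adj Γ x b ≡ true →
                               Φ (W ∖ (b ∷ a ∷ y ∷ x ∷ [])) ≤[ 36 / 144 ] Φ W → Bound W
      rule-paired-deg3-cheap x~a x~b Φxyab = conclude
        (branch Wx (nbr x~b ∷ nbr x~a ∷ nbr (partners-adj xy) ∷ centre ∷ []) Φxyab
        (remaining Wx ∈₀ (Φ-─ Wx)))

      rule-paired-deg3 : ∀ {a b a′ b′ c d} → Nbrs⊆ W x (y ∷ a ∷ b ∷ []) →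
                         All (Nbr W (y ∷ []) x) (a ∷ b ∷ []) → a ≢ b →
                         Partners a a′ → W a′ ≡ true → Partners b b′ → W b′ ≡ true → a′ ≢ b →
                         All (Nbr W (x ∷ []) y) (c ∷ d ∷ []) → c ≢ d → Bound W
      rule-paired-deg3 {a} {b} {a′} {b′} {c} {d} N⊆ xab@(xa@(x~a , Wa , a≢y ∷ a≢x ∷ []) ∷ (x~b , Wb , b≢y ∷ b≢x ∷ []) ∷ [])
                       a≢b aa′ Wa′ bb′ Wb′ a′≢b ycd@((y~c , _) ∷ (y~d , _) ∷ []) c≢d = conclude
        (branch Wx (nbr x~a ∷ nbr x~b ∷ nbr (partners-adj xy) ∷ centre ∷ []) Φxyab
        (branch Wy (nbr y~c ∷ nbr y~d ∷ earlier ∈₀ ∷ centre ∷ []) Φyxcd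
        (branch Wa (nbr (partners-adj aa′) ∷ centre ∷ earlier ∈₀ ∷ earlier ∈₁ ∷ []) (Φxy─-partner xa aa′ Wa′)
        (branch Wb (nbr (partners-adj bb′) ∷ centre ∷ earlier ∈₀ ∷ earlier ∈₁ ∷ earlier ∈₂ ∷ []) Φxyabb′
        (closed Wx ∈₃ (Nbrs⊆-weaken (∈₂ ∷ ∈₁ ∷ ∈₀ ∷ []) N⊆))))))
        where
        Φxyab : Φ (W ∖ (a ∷ b ∷ y ∷ x ∷ [])) ≤[ 54 / 192 ] Φ W
        Φxyab = ≤[]-trans (Φ-∖ (a ∷ b ∷ []) ((a≢b ∷ []) ∷ [] ∷ []) (Nbr⇒∈-∖ (y ∷ []) xab)) Φxy
        Φyxcd : Φ (W ∖ (c ∷ d ∷ x ∷ y ∷ [])) ≤[ 54 / 192 ] Φ W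
        Φyxcd = ≤[]-trans (Φ-∖ (c ∷ d ∷ []) ((c≢d ∷ []) ∷ [] ∷ []) (Nbr⇒∈-∖ (x ∷ []) ycd)) (Φ-pair Wy (partners-sym xy) Wx)
        b′≢a : b′ ≢ a
        b′≢a refl = a′≢b (partners-unique aa′ (partners-sym bb′))
        Φxyabb′ : Φ (W ∖ (b′ ∷ b ∷ a ∷ y ∷ x ∷ [])) ≤[ 108 / 576 ] Φ W
        Φxyabb′ = ≤[]-trans
          (Φ-─-unpaired (∈W∖ Wb′ (partners-≢ (partners-sym bb′) ∷ b′≢a ∷ partner-≢ (partners-sym xy) bb′ b≢y b≢x ∷
                                  partner-≢ xy bb′ b≢x b≢y ∷ []))
                        (unpaired-∖ {W} (b ∷ a ∷ y ∷ x ∷ []) (partners-sym bb′) ∈₀))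
          (≤[]-trans (Φ-─ (∈W∖ Wb (a≢b ∘ sym ∷ b≢y ∷ b≢x ∷ []))) (Φxy─ Wa a≢y a≢x))

      rule-paired-deg4 : ∀ {a b c} → All (Nbr W (y ∷ []) x) (a ∷ b ∷ c ∷ []) → Unique (a ∷ b ∷ c ∷ []) → Bound W
      rule-paired-deg4 abc@((x~a , _) ∷ (x~b , _) ∷ (x~c , _) ∷ []) distinct = conclude
        (branch Wx (nbr x~a ∷ nbr x~b ∷ nbr x~c ∷ nbr (partners-adj xy) ∷ centre ∷ [])
          (≤[]-trans (Φ-∖ _ distinct (Nbr⇒∈-∖ (y ∷ []) abc)) Φxy)
        (remaining Wx ∈₀ (Φ-─ Wx)))

      paired-deg2 : ∀ {a c} → Nbrs⊆ W x (y ∷ a ∷ []) → Nbr W (y ∷ []) x a → Nbr W (x ∷ []) y c → Bound W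
      paired-deg2 {a} N⊆ xa@(x~a , Wa , _ ∷ a≢x ∷ []) yc with pairing W a
      ... | inj₁ (a′ , aa′ , Wa′) = rule-paired-deg2-paired N⊆ xa aa′ Wa′ yc
      ... | inj₂ una with nbhd-of W (y ∷ x ∷ []) a
      ...   | nbhd (b ∷ _) (ab ∷ _) _ _ = rule-paired-deg2-unpaired N⊆ xa una ab yc
      ...   | nbhd [] [] _ Na with adj Γ y a in y~a
      ...     | true  = rule-paired-deg2-triangle N⊆ xa una y~a
      ...     | false = rule-pendant Wa una (adj-sym x~a , Wx , a≢x ∘ sym ∷ []) Na⊆x
        where
        Na⊆x : Nbrs⊆ W a (x ∷ [])
        Na⊆x a~u Wu with Na a~u Wu
        ... | ∈₀ = contradiction (trans (sym (adj-sym a~u)) y~a) λ ()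
        ... | ∈₁ = ∈₀

      paired-deg3 : ∀ {a b c d} → Nbrs⊆ W x (y ∷ a ∷ b ∷ []) → All (Nbr W (y ∷ []) x) (a ∷ b ∷ []) → a ≢ b →
                    All (Nbr W (x ∷ []) y) (c ∷ d ∷ []) → c ≢ d → Bound W
      paired-deg3 {a} {b} N⊆ xab@(xa@(x~a , Wa , a≢y ∷ a≢x ∷ []) ∷ (x~b , Wb , b≢y ∷ b≢x ∷ []) ∷ []) a≢b ycd c≢d
        with pairing W a | pairing W b
      ... | inj₂ una | _ = rule-paired-deg3-cheap x~a x~b
        (≤[]-trans (Φ-─ (∈W∖ Wb (a≢b ∘ sym ∷ b≢y ∷ b≢x ∷ [])))
        (≤[]-trans (Φ-─-unpaired (∈W∖ Wa (a≢y ∷ a≢x ∷ [])) (unpaired-∖′ (y ∷ x ∷ []) una)) Φxy))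
      ... | _ | inj₂ unb = rule-paired-deg3-cheap x~b x~a
        (≤[]-trans (Φ-─ (∈W∖ Wa (a≢b ∷ a≢y ∷ a≢x ∷ [])))
        (≤[]-trans (Φ-─-unpaired (∈W∖ Wb (b≢y ∷ b≢x ∷ [])) (unpaired-∖′ (y ∷ x ∷ []) unb)) Φxy))
      ... | inj₁ (a′ , aa′ , Wa′) | inj₁ (b′ , bb′ , Wb′) with a′ Finₚ.≟ b
      ...   | yes refl = rule-paired-deg3-cheap x~a x~b (Φxy─-partner xa aa′ Wa′)
      ...   | no a′≢b = rule-paired-deg3 N⊆ xab a≢b aa′ Wa′ bb′ Wb′ a′≢b ycd c≢d

    paired-case : ∀ {x y} → W x ≡ true → Partners x y → W y ≡ true → Bound W
    paired-case {x} {y} Wx xy Wy with nbhd-of W (y ∷ []) x | nbhd-of W (x ∷ []) y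
    ... | nbhd [] _ _ Nx | _ = rule-paired-pendant Wx xy Wy Nx
    ... | _ | nbhd [] _ _ Ny = rule-paired-pendant Wy (partners-sym xy) Wx Ny
    ... | nbhd (a ∷ b ∷ c ∷ _) (xa ∷ xb ∷ xc ∷ _) ((a≢b ∷ a≢c ∷ _) ∷ (b≢c ∷ _) ∷ _) _ | _ =
      rule-paired-deg4 Wx xy Wy (xa ∷ xb ∷ xc ∷ []) ((a≢b ∷ a≢c ∷ []) ∷ (b≢c ∷ []) ∷ [] ∷ [])
    ... | nbhd (a ∷ []) (xa ∷ []) _ Nx | nbhd (c ∷ _) (yc ∷ _) _ _ = paired-deg2 Wx xy Wy Nx xa yc
    ... | nbhd (a ∷ b ∷ []) (xa ∷ _) _ _ | nbhd (c ∷ []) (yc ∷ []) _ Ny = paired-deg2 Wy (partners-sym xy) Wx Ny yc xa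
    ... | nbhd (a ∷ b ∷ []) xab ((a≢b ∷ []) ∷ _) Nx | nbhd (c ∷ d ∷ _) (yc ∷ yd ∷ _) ((c≢d ∷ _) ∷ _) _ =
      paired-deg3 Wx xy Wy Nx xab a≢b (yc ∷ yd ∷ []) c≢d

    unpaired-case : ∀ {v} → W v ≡ true → Unpaired W v → Bound W
    unpaired-case {v} Wv unv with nbhd-of W [] v
    ... | nbhd [] _ _ Nv = rule-isolated Wv unv Nv
    ... | nbhd (a ∷ []) (va ∷ []) _ Nv = rule-pendant Wv unv va Nv
    ... | nbhd (a ∷ b ∷ c ∷ _) (va ∷ vb ∷ vc ∷ _) ((a≢b ∷ a≢c ∷ _) ∷ (b≢c ∷ _) ∷ _) _ =
      rule-unpaired-deg3 Wv unv (va ∷ vb ∷ vc ∷ []) ((a≢b ∷ a≢c ∷ []) ∷ (b≢c ∷ []) ∷ [] ∷ [])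
    ... | nbhd (a ∷ b ∷ []) (va@(v~a , Wa , _) ∷ vb@(_ , Wb , _) ∷ []) ((a≢b ∷ []) ∷ _) Nv with pairing W a | pairing W b
    ...   | inj₁ (a′ , aa′ , Wa′) | _ = paired-case Wa aa′ Wa′
    ...   | inj₂ _ | inj₁ (b′ , bb′ , Wb′) = paired-case Wb bb′ Wb′
    ...   | inj₂ una | inj₂ unb with nbhd-of W (v ∷ []) a
    ...     | nbhd [] _ _ Na = rule-pendant Wa una (adj-sym v~a , Wv , adj⇒≢ v~a ∷ []) Na
    ...     | nbhd (r ∷ _) (ar ∷ _) _ _ = rule-unpaired-deg2 Wv unv Nv va una vb unb a≢b ar

    empty-case : (∀ v → W v ≡ false) → Bound W
    empty-case empty = begin
      #MIS W * 2 ^ n ≤⟨ *-monoˡ-≤ (2 ^ n) (#MIS-empty empty) ⟩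
      1 * 2 ^ n      ≡⟨ *-identityˡ (2 ^ n) ⟩
      2 ^ n          ≡⟨ Φ-empty empty ⟨
      Φ W            ∎
      where open ≤-Reasoning

    bound : Bound W
    bound with Finₚ.any? (λ v → W v Boolₚ.≟ true)
    ... | no ∄v = empty-case λ v → Boolₚ.¬-not λ Wv → ∄v (v , Wv)
    ... | yes (v , Wv) with pairing W v
    ...   | inj₁ (y , vy , Wy) = paired-case Wv vy Wy
    ...   | inj₂ unv           = unpaired-case Wv unv

  Φ-bound : ∀ W → Bound W
  Φ-bound = <ˢ-rec Bound Branching.bound

  -- Gadgets

  record Fan (C : VertexSet) (x y : Fin n) : Set where
    constructor fan
    field
      a b c    : Fin n
      adjacent : All (Nbr C (y ∷ []) x) (a ∷ b ∷ c ∷ [])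
      distinct : Unique (a ∷ b ∷ c ∷ [])

  length-filter-≢ : ∀ {L : List (Fin n)} y → Unique L → length L ≤ suc (length (filter (λ u → ¬? (u Finₚ.≟ y)) L))
  length-filter-≢ {[]}    y []              = z≤n
  length-filter-≢ {u ∷ L} y (u∉L ∷ unique) with u Finₚ.≟ y
  ... | yes refl = s≤s (≤-reflexive (cong length
                     (sym (filter-all (λ w → ¬? (w Finₚ.≟ u)) (All.map (λ u≢w → u≢w ∘ sym) u∉L)))))
  ... | no _     = s≤s (length-filter-≢ y unique)

  fan-from : ∀ {C x y} L → 3 ≤ length L → All (Nbr C (y ∷ []) x) L → Unique L → Fan C x y
  fan-from (a ∷ b ∷ c ∷ _) _ (na ∷ nb ∷ nc ∷ _) ((a≢b ∷ a≢c ∷ _) ∷ (b≢c ∷ _) ∷ _) =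
    fan a b c (na ∷ nb ∷ nc ∷ []) ((a≢b ∷ a≢c ∷ []) ∷ (b≢c ∷ []) ∷ [] ∷ [])
  fan-from []              ()                _ _
  fan-from (_ ∷ [])        (s≤s ())          _ _
  fan-from (_ ∷ _ ∷ [])    (s≤s (s≤s ()))    _ _

  fan-of : ∀ {C x y} → 4 ≤ length (nbrs C x) → Fan C x y
  fan-of {C} {x} {y} deg = fan-from (filter ≢y? list) long nbrs′ (Uniqueₚ.filter⁺ ≢y? distinct)
    where
    open Nbhd (nbhd-of C [] x)
    ≢y? = λ u → ¬? (u Finₚ.≟ y)
    nbrs′ : All (Nbr C (y ∷ []) x) (filter ≢y? list)
    nbrs′ = All.tabulate λ u∈ → let u∈L , u≢y = ∈-filter⁻ ≢y? u∈
                                    xu , Cu , u≢x = All.lookup sound u∈L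
                                in xu , Cu , u≢y ∷ u≢x
    long : 3 ≤ length (filter ≢y? list)
    long = ≤-pred (≤-trans deg (length-filter-≢ y distinct))

  record Gadget (U : VertexSet) : Set where
    field
      x y  : Fin n
      xy   : Partners x y
      Ux   : U x ≡ true
      Uy   : U y ≡ true
      fanx : Fan U x y
      fany : Fan U y x

    X Y XY : List (Fin n)
    X  = Fan.a fanx ∷ Fan.b fanx ∷ Fan.c fanx ∷ y ∷ x ∷ []
    Y  = Fan.a fany ∷ Fan.b fany ∷ Fan.c fany ∷ x ∷ y ∷ []
    XY = y ∷ x ∷ []

    open Fan fanx renaming (a to a₁; b to a₂; c to a₃; adjacent to xa; distinct to a-distinct)
    open Fan fany renaming (a to b₁; b to b₂; c to b₃; adjacent to yb; distinct to b-distinct)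

    X⊆U : All (λ r → U r ≡ true) X
    X⊆U = Allₚ.++⁺ (All.map (proj₁ ∘ proj₂) xa) (Uy ∷ Ux ∷ [])

    Y⊆U : All (λ r → U r ≡ true) Y
    Y⊆U = Allₚ.++⁺ (All.map (proj₁ ∘ proj₂) yb) (Ux ∷ Uy ∷ [])

    ─N-⊆-X : ∀ {W} → W ─N[ x ] ⊆ W ∖ X
    ─N-⊆-X {W} {v} =
      ─N-⊆-∖ {W} {x} {[]} {X} (Allₚ.++⁺ (All.map (nbr ∘ proj₁) xa) (nbr (partners-adj xy) ∷ centre ∷ [])) {v}

    ─N-⊆-Y : ∀ {W} → (W ∖ (x ∷ [])) ─N[ y ] ⊆ W ∖ Y
    ─N-⊆-Y {W} {v} =
      ─N-⊆-∖ {W} {y} {x ∷ []} {Y} (Allₚ.++⁺ (All.map (nbr ∘ proj₁) yb) (earlier ∈₀ ∷ centre ∷ [])) {v}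

    module _ {C : VertexSet} (U⊆C : U ⊆ C) where

      Φ-X : Φ (C ∖ X) ≤[ 162 / 768 ] Φ C
      Φ-X = ≤[]-trans (Φ-∖ (a₁ ∷ a₂ ∷ a₃ ∷ []) a-distinct
                             (Nbr⇒∈-∖ (y ∷ []) (All.map (Nbr-mono {U} {C} {y ∷ []} U⊆C) xa)))
                      (Φ-pair (U⊆C Ux) xy (U⊆C Uy))

      Φ-Y : Φ (C ∖ Y) ≤[ 162 / 768 ] Φ C
      Φ-Y = ≤[]-trans (Φ-∖ (b₁ ∷ b₂ ∷ b₃ ∷ []) b-distinct
                             (Nbr⇒∈-∖ (x ∷ []) (All.map (Nbr-mono {U} {C} {x ∷ []} U⊆C) yb)))
                      (Φ-pair (U⊆C Uy) (partners-sym xy) (U⊆C Ux))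

      Φ-gadget : Φ (C ∖ X) + Φ (C ∖ Y) + Φ (C ∖ XY) ≤[ 59 / 64 ] Φ C
      Φ-gadget = ≤[]-weaken (≤ᵇ⇒≤ _ _ _) (≤[]-+ (≤[]-+ Φ-X Φ-Y) (Φ-pair (U⊆C Ux) xy (U⊆C Uy)))

  gadget-of : ∀ {U} → ∃[ e ] (U (proj₁ (edge M e)) ≡ true × U (proj₂ (edge M e)) ≡ true) →
              (∀ v → covered M v → U v ≡ true → 4 ≤ length (nbrs U v)) → Gadget U
  gadget-of (e , Ux , Uy) deg = record
    { xy = e , forward ; Ux = Ux ; Uy = Uy
    ; fanx = fan-of (deg _ (e , inj₁ refl) Ux) ; fany = fan-of (deg _ (e , inj₂ refl) Uy) }

  -- Φ summed over the 3^k leaves of the branching on the gadgets: at each gadget the independent set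
  -- contains x (delete X), or contains y (delete Y), or avoids both (delete x and y).
  Ψ : ∀ {k} (U : Fin k → VertexSet) → (∀ i → Gadget (U i)) → VertexSet → ℕ
  Ψ {zero}  U G C = Φ C
  Ψ {suc k} U G C = Ψ (U ∘ suc) (G ∘ suc) (C ∖ X) + Ψ (U ∘ suc) (G ∘ suc) (C ∖ Y) + Ψ (U ∘ suc) (G ∘ suc) (C ∖ XY)
    where open Gadget (G zero)

  Ψ-mono : ∀ {k} U G {B C} → B ⊆ C → Ψ {k} U G B ≤ Ψ U G C
  Ψ-mono {zero}  U G B⊆C = Φ-mono B⊆C
  Ψ-mono {suc k} U G {B} {C} B⊆C = +-mono-≤ (+-mono-≤ (mono X) (mono Y)) (mono XY)
    where
    open Gadget (G zero)
    mono : ∀ R → Ψ (U ∘ suc) (G ∘ suc) (B ∖ R) ≤ Ψ (U ∘ suc) (G ∘ suc) (C ∖ R)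
    mono R = Ψ-mono (U ∘ suc) (G ∘ suc) {B ∖ R} {C ∖ R} (∖-mono R B⊆C)

  #MIS≤Ψ : ∀ {k} U G W → #MIS W * 2 ^ n ≤ Ψ {k} U G W
  #MIS≤Ψ {zero}  U G W = Φ-bound W
  #MIS≤Ψ {suc k} U G W = begin
    #MIS W * 2 ^ n
      ≤⟨ *-monoˡ-≤ (2 ^ n) split ⟩
    (#MIS B₁ + (#MIS B₂ + #MIS B₃)) * 2 ^ n
      ≡⟨ solve 4 (λ a b c p → (a :+ (b :+ c)) :* p := a :* p :+ b :* p :+ c :* p) refl (#MIS B₁) (#MIS B₂) (#MIS B₃) (2 ^ n) ⟩
    #MIS B₁ * 2 ^ n + #MIS B₂ * 2 ^ n + #MIS B₃ * 2 ^ n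
      ≤⟨ +-mono-≤ (+-mono-≤ (via {B₁} {W ∖ X} (λ {v} → ─N-⊆-X {W} {v})) (via {B₂} {W ∖ Y} (λ {v} → ─N-⊆-Y {W} {v})))
                  (via {B₃} id) ⟩
    Ψ U G W
      ∎
    where
    open Gadget (G zero)
    open ≤-Reasoning
    open +-*-Solver
    B₁ = W ─N[ x ]
    B₂ = (W ∖ (x ∷ [])) ─N[ y ]
    B₃ = W ∖ XY
    via : ∀ {B C} → B ⊆ C → #MIS B * 2 ^ n ≤ Ψ (U ∘ suc) (G ∘ suc) C
    via {B} {C} B⊆C = ≤-trans (#MIS≤Ψ (U ∘ suc) (G ∘ suc) B) (Ψ-mono (U ∘ suc) (G ∘ suc) {B} {C} B⊆C)
    split : #MIS W ≤ #MIS B₁ + (#MIS B₂ + #MIS B₃)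
    split = begin
      #MIS W                                            ≤⟨ #MIS≤#MIS-avoiding[] W ⟩
      #MIS-avoiding W []                                ≤⟨ #MIS-avoiding-─N W [] x ⟩
      #MIS B₁ + #MIS-avoiding W (x ∷ [])                ≤⟨ +-monoʳ-≤ (#MIS B₁) (#MIS-avoiding-─N W (x ∷ []) y) ⟩
      #MIS B₁ + (#MIS B₂ + #MIS-avoiding W (y ∷ x ∷ []))
        ≤⟨ +-monoʳ-≤ (#MIS B₁) (+-monoʳ-≤ (#MIS B₂) (#MIS-avoiding≤#MIS-∖ W (y ∷ x ∷ []))) ⟩
      #MIS B₁ + (#MIS B₂ + #MIS B₃)                     ∎

  Disjoint : ∀ {k} → (Fin k → VertexSet) → Set
  Disjoint U = ∀ i j → i ≢ j → ∀ v → ¬ (U i v ≡ true × U j v ≡ true)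

  ⊆-∖-apart : ∀ {U′ U C : VertexSet} {R} → U′ ⊆ C → All (λ r → U r ≡ true) R →
              (∀ v → ¬ (U′ v ≡ true × U v ≡ true)) → U′ ⊆ C ∖ R
  ⊆-∖-apart {C = C} U′⊆C R⊆U apart {v} U′v =
    ∈-∖⁺ {p = C} (U′⊆C U′v) (All.map (λ Ur → λ { refl → apart v (U′v , Ur) }) R⊆U)

  Ψ-bound : ∀ {k} U G C → Disjoint U → (∀ i → U i ⊆ C) → Ψ {k} U G C ≤[ 59 ^ k / 64 ^ k ] Φ C
  Ψ-bound {zero}  U G C _ _ = *≤* ≤-refl
  Ψ-bound {suc k} U G C disjoint U⊆C = subst₂ (λ p q → Ψ U G C ≤[ p / q ] Φ C) (*-comm (59 ^ k) 59) (*-comm (64 ^ k) 64)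
    (≤[]-trans (+-mono-≤[] (+-mono-≤[] (IH X X⊆U) (IH Y Y⊆U)) (IH XY (Uy ∷ Ux ∷ []))) (Φ-gadget (U⊆C zero)))
    where
    open Gadget (G zero)
    IH : ∀ R → All (λ r → U zero r ≡ true) R → Ψ (U ∘ suc) (G ∘ suc) (C ∖ R) ≤[ 59 ^ k / 64 ^ k ] Φ (C ∖ R)
    IH R R⊆U₀ = Ψ-bound (U ∘ suc) (G ∘ suc) (C ∖ R) (λ i j i≢j → disjoint (suc i) (suc j) (i≢j ∘ Finₚ.suc-injective))
      λ i {v} → ⊆-∖-apart {U (suc i)} {U zero} {C} {R} (U⊆C (suc i)) R⊆U₀ (disjoint (suc i) zero λ ()) {v}

lemma4p2 : (n m k : ℕ) (Γ : Graph n) (M : Matching Γ m) (V : Fin k → VSet n) →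
    (∀ i j → i ≢ j → ∀ v → ¬ (v ∈ V i × v ∈ V j)) →
    (∀ i → ∃[ e ] (proj₁ (edge M e) ∈ V i × proj₂ (edge M e) ∈ V i)) →
    (∀ i v → covered M v → v ∈ V i → 4 ≤ degIn Γ (V i) v) →
    mis Γ * 64 ^ k * 2 ^ n ≤ 59 ^ k * 2 ^ (3 * m) * 3 ^ (n ∸ 2 * m)
lemma4p2 n m k Γ M V disjoint has-edge degree = begin
  mis Γ * 64 ^ k * 2 ^ n                   ≡⟨ xy∙z≈y∙xz (mis Γ) (64 ^ k) (2 ^ n) ⟩
  64 ^ k * (mis Γ * 2 ^ n)                 ≤⟨ *-monoʳ-≤ (64 ^ k) (≤-trans (*-monoˡ-≤ (2 ^ n) mis≤#MIS) (#MIS≤Ψ U G full)) ⟩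
  64 ^ k * Ψ U G full                      ≤⟨ drop-*≤* (Ψ-bound U G full disjoint (λ i _ → refl)) ⟩
  59 ^ k * Φ full                          ≤⟨ *-monoʳ-≤ (59 ^ k) Φ-full ⟩
  59 ^ k * (2 ^ (3 * m) * 3 ^ (n ∸ 2 * m)) ≡⟨ *-assoc (59 ^ k) _ _ ⟨
  59 ^ k * 2 ^ (3 * m) * 3 ^ (n ∸ 2 * m)   ∎
  where
  open ≤-Reasoning
  open MatchingBound Γ M
  U : Fin k → VertexSet
  U i = lookup (V i)
  G : ∀ i → Gadget (U i)
  G i = gadget-of (has-edge i) (degree i)
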